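{- Let $M$ be a quaternary matroid on finite ground set $V$, viewed as the set system $(V,\mathcal{B})$ of its bases, and let $A$ be a matrix over $GF(4)$ with columns indexed by $V$ representing $M$ (i.e. $M=M(\ker(A))$). Then the matroid $M(\mathcal{BC}_{\ker(A)})$, described by its bases, equals the set system $\max(M+V)$. In particular, $M(\mathcal{BC}_{\ker(A)})$ depends only on $M$ and not on the chosen representation $A$.
   Context: For a subspace $L\subseteq GF(4)^V$, $M(L)$ is the matroid on $V$ whose circuits are the inclusion-minimal nonempty sets $X\subseteq V$ that are the support of some vector of $L$ (the support of $v$ is the set of coordinates where $v$ is nonzero). $\mathrm{inv}$ is the nontrivial field automorphism $x\mapsto x^2$ of $GF(4)$, applied coordinatewise to vectors and elementwise to subspaces. $L^\perp$ is the orthogonal complement of $L$ with respect to the standard bilinear form $\sum_i x_iy_i$. The bicycle space of $L$ is $\mathcal{BC}_L=L\cap\mathrm{inv}(L^\perp)$. For a set system $M=(V,E)$ (with $E\subseteq 2^V$), $M+V=(V,E')$ where $X\in E'$ iff $|\{Z\in E\mid Z\subseteq X\}|$ is odd (equivalently, apply loop complementation $+u$ for each $u\in V$, where $M+u=(V,E\triangle\{Y\cup\{u\}\mid Y\in E,u\notin Y\})$). $\max(M)=(V,\max(E))$ where $\max(E)$ is the family of inclusion-maximal members of $E$. -}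

module Defs where

open import Data.Nat using (ℕ; zero; suc; _%_)
open import Data.Fin using (Fin; zero; suc)
open import Data.Fin.Subset using (Subset; _∈_; _⊆_)
open import Data.List using (List; length)
import Data.List.Membership.Propositional as LM
open import Data.List.Relation.Unary.Unique.Propositional using (Unique)
open import Data.Product using (Σ; ∃; _×_; _,_)
open import Relation.Binary.PropositionalEquality using (_≡_; _≢_)
open import Relation.Nullary using (¬_)
open import Function.Bundles using (_⇔_)

data GF4 : Set where
  𝟘 𝟙 ω ω² : GF4

infixl 6 _⊕_
infixl 7 _⊗_

_⊕_ : GF4 → GF4 → GF4
𝟘  ⊕ y  = y
𝟙  ⊕ 𝟘  = 𝟙
𝟙  ⊕ 𝟙  = 𝟘
𝟙  ⊕ ω  = ω²
𝟙  ⊕ ω² = ω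
ω  ⊕ 𝟘  = ω
ω  ⊕ 𝟙  = ω²
ω  ⊕ ω  = 𝟘
ω  ⊕ ω² = 𝟙
ω² ⊕ 𝟘  = ω²
ω² ⊕ 𝟙  = ω
ω² ⊕ ω  = 𝟙
ω² ⊕ ω² = 𝟘

_⊗_ : GF4 → GF4 → GF4
𝟘  ⊗ y  = 𝟘
𝟙  ⊗ y  = y
ω  ⊗ 𝟘  = 𝟘
ω  ⊗ 𝟙  = ω
ω  ⊗ ω  = ω²
ω  ⊗ ω² = 𝟙
ω² ⊗ 𝟘  = 𝟘
ω² ⊗ 𝟙  = ω²
ω² ⊗ ω  = 𝟙
ω² ⊗ ω² = ω

-- the nontrivial field automorphism x ↦ x²
inv : GF4 → GF4
inv 𝟘  = 𝟘
inv 𝟙  = 𝟙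
inv ω  = ω²
inv ω² = ω

Vect : ℕ → Set
Vect n = Fin n → GF4

sumF : ∀ {n} → (Fin n → GF4) → GF4
sumF {zero}  f = 𝟘
sumF {suc n} f = f zero ⊕ sumF (λ i → f (suc i))

dot : ∀ {n} → Vect n → Vect n → GF4
dot x y = sumF (λ i → x i ⊗ y i)

VSet : ℕ → Set₁
VSet n = Vect n → Set

ker : ∀ {m n} → (Fin m → Fin n → GF4) → VSet n
ker A v = ∀ r → dot (A r) v ≡ 𝟘

_⊥ : ∀ {n} → VSet n → VSet n
(L ⊥) w = ∀ v → L v → dot v w ≡ 𝟘

invS : ∀ {n} → VSet n → VSet n
invS L u = Σ (Vect _) λ w → L w × (∀ i → u i ≡ inv (w i))

_∩_ : ∀ {n} → VSet n → VSet n → VSet n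
(L ∩ K) v = L v × K v

BC : ∀ {n} → VSet n → VSet n
BC L = L ∩ invS (L ⊥)

Nonempty : ∀ {n} → Subset n → Set
Nonempty X = ∃ λ i → i ∈ X

IsSupport : ∀ {n} → Vect n → Subset n → Set
IsSupport v X = ∀ i → (i ∈ X) ⇔ (v i ≢ 𝟘)

SupportIn : ∀ {n} → VSet n → Subset n → Set
SupportIn L X = Σ (Vect _) λ v → L v × IsSupport v X

Circuit : ∀ {n} → VSet n → Subset n → Set
Circuit L C = Nonempty C × SupportIn L C
  × (∀ D → Nonempty D → SupportIn L D → D ⊆ C → D ≡ C)

Independent : ∀ {n} → VSet n → Subset n → Set
Independent L X = ∀ C → Circuit L C → ¬ (C ⊆ X)

SetSystem : ℕ → Set₁
SetSystem n = Subset n → Set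

maxS : ∀ {n} → SetSystem n → SetSystem n
maxS E X = E X × (∀ Y → E Y → X ⊆ Y → Y ≡ X)

Bases : ∀ {n} → VSet n → SetSystem n
Bases L = maxS (Independent L)

-- M + V : X ∈ E' iff |{Z ∈ E | Z ⊆ X}| is odd.
-- The family {Z ∈ E | Z ⊆ X} is given by a duplicate-free list enumerating it.
plusV : ∀ {n} → SetSystem n → SetSystem n
plusV E X = Σ (List (Subset _)) λ Zs → Unique Zs
  × (∀ Z → (Z LM.∈ Zs) ⇔ (E Z × Z ⊆ X))
  × (length Zs % 2 ≡ 1)

_≐_ : ∀ {n} → SetSystem n → SetSystem n → Set
E ≐ F = ∀ X → E X ⇔ F X

module Submission where

-- Write ⟨ u , v ⟩ = Σᵢ uᵢ · inv vᵢ for the Hermitian form on GF(4)ⁿ. As inv (L⊥) is the ⟨,⟩-orthogonal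
-- of L, the bicycle space of L is the radical of the form restricted to L. The key fact is that M(L)
-- has an odd number of bases exactly when this restricted form is nondegenerate. It is proved by
-- deleting and contracting one element: a loop or a coloop changes neither side, and otherwise the
-- number of bases is the sum of those of the deletion and the contraction, while the nondegeneracy of
-- L is the exclusive or of theirs (Riesz representation in the deletion gives the hard case). Applied
-- to the space L ↾ X, whose bases are the bases of M(L) inside X when X contains one, it shows that a
-- set containing an odd number of bases of M supports no radical vector, and that every basis of
-- M(BC_L) contains an odd number of bases of M. So the bases of M(BC_L) are the maximal sets
-- containing an odd number of bases of M, which are the maximal sets of M + V.

open import Defs
open import Data.Bool using (true; not)
import Data.Bool.Properties as Boolₚ
open import Data.Empty using (⊥; ⊥-elim)
open import Data.Fin using (Fin; zero; suc; combine; funToFin; finToFun; punchOut)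
import Data.Fin.Properties as Finₚ
open import Data.Fin.Subset using (Subset; _∈_; _∉_; _⊆_; _∪_; ⁅_⁆; inside; outside; ∣_∣) renaming (⊥ to ∅)
open import Data.Fin.Subset.Properties
  using ( _∈?_; _⊆?_; ⊆-refl; ⊆-trans; ⊆-antisym; x∈⁅x⁆; x∈⁅y⁆⇒x≡y; x∈p∪q⁺; x∈p∪q⁻; p⊆p∪q; ∉⊥
        ; drop-there; drop-not-there; ∪-identityʳ; p⊂q⇒∣p∣<∣q∣)
open import Data.List using (List; []; _∷_; allFin; map; _++_; length)
import Data.List.Properties as Listₚ
open import Data.List.Membership.Propositional using () renaming (_∈_ to _∈ₗ_)
open import Data.List.Membership.Propositional.Properties
  using (∈-allFin; ∈-map⁺; ∈-map⁻; ∈-++⁺ˡ; ∈-++⁺ʳ; ∈-++⁻)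
open import Data.List.Membership.Propositional.Properties.WithK using (unique∧set⇒bag)
open import Data.List.Relation.Binary.BagAndSetEquality using (∼bag⇒↭)
open import Data.List.Relation.Binary.Permutation.Propositional.Properties using (↭-length)
open import Data.List.Relation.Unary.All using ([])
open import Data.List.Relation.Unary.Any using () renaming (here to hereₗ; there to thereₗ)
open import Data.List.Relation.Unary.Unique.Propositional using (Unique; []; _∷_)
import Data.List.Relation.Unary.Unique.Propositional.Properties as Uniqueₚ
open import Data.Nat using (ℕ; zero; suc; _+_; _^_; _<_; _%_; parity)
open import Data.Nat.DivMod using ([m+n]%n≡m%n)
open import Data.Nat.Induction using (<-wellFounded)
import Data.Nat.Properties as ℕₚ
open import Data.Parity.Base as ℙ using (Parity; 0ℙ; 1ℙ)
open import Data.Parity.Properties using (+-homo-+)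
open import Data.Product using (∃; ∃-syntax; _×_; _,_; proj₁; proj₂)
open import Data.Sum using (_⊎_; inj₁; inj₂)
open import Data.Vec using ([]; _∷_; here; there; tabulate)
open import Data.Vec.Functional using (tail) renaming (_∷_ to _∷ᶠ_)
open import Data.Vec.Properties using (lookup∘tabulate; []=⇒lookup; lookup⇒[]=; tabulate-cong)
import Data.Vec.Properties as Vecₚ
open import Function using (_∘_)
open import Function.Bundles using (_⇔_; mk⇔; Equivalence)
open import Function.Properties.Equivalence using () renaming (trans to ⇔-trans; sym to ⇔-sym)
open import Induction.WellFounded using (Acc; acc)
open import Relation.Binary.Definitions using (DecidableEquality)
open import Relation.Binary.PropositionalEquality
  using (_≡_; _≢_; _≗_; refl; sym; trans; cong; cong₂; subst; module ≡-Reasoning)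
open import Relation.Nullary using (¬_; Dec; yes; no; ¬?; _→-dec_; _×-dec_; contradiction)
open import Relation.Nullary.Decidable using (map′; from-yes; does; _⊎-dec_)

toFin : GF4 → Fin 4
toFin 𝟘  = zero
toFin 𝟙  = suc zero
toFin ω  = suc (suc zero)
toFin ω² = suc (suc (suc zero))

fromFin : Fin 4 → GF4
fromFin zero                   = 𝟘
fromFin (suc zero)             = 𝟙
fromFin (suc (suc zero))       = ω
fromFin (suc (suc (suc zero))) = ω²

fromFin-toFin : ∀ x → fromFin (toFin x) ≡ x
fromFin-toFin 𝟘  = refl
fromFin-toFin 𝟙  = refl
fromFin-toFin ω  = refl
fromFin-toFin ω² = refl

toFin-fromFin : ∀ k → toFin (fromFin k) ≡ k
toFin-fromFin zero                   = refl
toFin-fromFin (suc zero)             = refl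
toFin-fromFin (suc (suc zero))       = refl
toFin-fromFin (suc (suc (suc zero))) = refl

toFin-injective : ∀ {x y} → toFin x ≡ toFin y → x ≡ y
toFin-injective {x} {y} e = trans (sym (fromFin-toFin x)) (trans (cong fromFin e) (fromFin-toFin y))

infix 4 _≟_
_≟_ : DecidableEquality GF4
x ≟ y = map′ toFin-injective (cong toFin) (toFin x Finₚ.≟ toFin y)

any? : {P : GF4 → Set} → (∀ x → Dec (P x)) → Dec (∃ P)
any? {P} P? = map′ (λ (k , p) → fromFin k , p) (λ (x , p) → toFin x , subst P (sym (fromFin-toFin x)) p)
                   (Finₚ.any? (P? ∘ fromFin))

all? : {P : GF4 → Set} → (∀ x → Dec (P x)) → Dec (∀ x → P x)
all? {P} P? = map′ (λ h x → subst P (fromFin-toFin x) (h (toFin x))) (λ h k → h (fromFin k))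
                   (Finₚ.all? (P? ∘ fromFin))

infix 8 _⁻¹
_⁻¹ : GF4 → GF4
𝟘 ⁻¹  = 𝟘
𝟙 ⁻¹  = 𝟙
ω ⁻¹  = ω²
ω² ⁻¹ = ω

⊕-identityʳ : ∀ x → x ⊕ 𝟘 ≡ x
⊕-identityʳ = from-yes (all? λ x → x ⊕ 𝟘 ≟ x)

⊕-self : ∀ x → x ⊕ x ≡ 𝟘
⊕-self = from-yes (all? λ x → x ⊕ x ≟ 𝟘)

⊕-assoc : ∀ x y z → (x ⊕ y) ⊕ z ≡ x ⊕ (y ⊕ z)
⊕-assoc = from-yes (all? λ x → all? λ y → all? λ z → (x ⊕ y) ⊕ z ≟ x ⊕ (y ⊕ z))

⊕≡𝟘⇒≡ : ∀ x y → x ⊕ y ≡ 𝟘 → x ≡ y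
⊕≡𝟘⇒≡ = from-yes (all? λ x → all? λ y → (x ⊕ y ≟ 𝟘) →-dec (x ≟ y))

≡⇒⊕≡𝟘 : ∀ {x y} → x ≡ y → x ⊕ y ≡ 𝟘
≡⇒⊕≡𝟘 {x} refl = ⊕-self x

⊕-cancelˡ : ∀ x y → x ⊕ y ≡ x → y ≡ 𝟘
⊕-cancelˡ = from-yes (all? λ x → all? λ y → (x ⊕ y ≟ x) →-dec (y ≟ 𝟘))

⊗-zeroʳ : ∀ x → x ⊗ 𝟘 ≡ 𝟘
⊗-zeroʳ = from-yes (all? λ x → x ⊗ 𝟘 ≟ 𝟘)

⊗-identityʳ : ∀ x → x ⊗ 𝟙 ≡ x
⊗-identityʳ = from-yes (all? λ x → x ⊗ 𝟙 ≟ x)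

⊗-assoc : ∀ x y z → (x ⊗ y) ⊗ z ≡ x ⊗ (y ⊗ z)
⊗-assoc = from-yes (all? λ x → all? λ y → all? λ z → (x ⊗ y) ⊗ z ≟ x ⊗ (y ⊗ z))

⊗-distribˡ-⊕ : ∀ x y z → x ⊗ (y ⊕ z) ≡ x ⊗ y ⊕ x ⊗ z
⊗-distribˡ-⊕ = from-yes (all? λ x → all? λ y → all? λ z → x ⊗ (y ⊕ z) ≟ x ⊗ y ⊕ x ⊗ z)

⊗-distribʳ-⊕ : ∀ x y z → (y ⊕ z) ⊗ x ≡ y ⊗ x ⊕ z ⊗ x
⊗-distribʳ-⊕ = from-yes (all? λ x → all? λ y → all? λ z → (y ⊕ z) ⊗ x ≟ y ⊗ x ⊕ z ⊗ x)

⁻¹-inverse : ∀ x → x ≢ 𝟘 → x ⁻¹ ⊗ x ≡ 𝟙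
⁻¹-inverse = from-yes (all? λ x → ¬? (x ≟ 𝟘) →-dec (x ⁻¹ ⊗ x ≟ 𝟙))

inv-involutive : ∀ x → inv (inv x) ≡ x
inv-involutive = from-yes (all? λ x → inv (inv x) ≟ x)

inv-⊕ : ∀ x y → inv (x ⊕ y) ≡ inv x ⊕ inv y
inv-⊕ = from-yes (all? λ x → all? λ y → inv (x ⊕ y) ≟ inv x ⊕ inv y)

inv-fixed : ∀ x → inv x ≡ x → x ≡ 𝟘 ⊎ x ≡ 𝟙
inv-fixed = from-yes (all? λ x → (inv x ≟ x) →-dec (x ≟ 𝟘 ⊎-dec x ≟ 𝟙))

scaled-cancel : ∀ a b c → a ≢ 𝟘 → b ⊗ c ⊕ (b ⊗ a ⁻¹) ⊗ (c ⊗ a) ≡ 𝟘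
scaled-cancel = from-yes (all? λ a → all? λ b → all? λ c → ¬? (a ≟ 𝟘) →-dec (b ⊗ c ⊕ (b ⊗ a ⁻¹) ⊗ (c ⊗ a) ≟ 𝟘))

norm≡𝟘⇒≡𝟘 : ∀ x → x ⊗ inv x ≡ 𝟘 → x ≡ 𝟘
norm≡𝟘⇒≡𝟘 = from-yes (all? λ x → (x ⊗ inv x ≟ 𝟘) →-dec (x ≟ 𝟘))

0ᵥ : ∀ {n} → Vect n
0ᵥ _ = 𝟘

infixl 6 _+ᵥ_
infixl 7 _·ᵥ_

_+ᵥ_ : ∀ {n} → Vect n → Vect n → Vect n
(v +ᵥ w) i = v i ⊕ w i

_·ᵥ_ : ∀ {n} → GF4 → Vect n → Vect n
(c ·ᵥ v) i = c ⊗ v i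

+ᵥ-cancelʳ : ∀ {n} (v w : Vect n) → (v +ᵥ w) +ᵥ w ≗ v
+ᵥ-cancelʳ v w i = trans (⊕-assoc (v i) (w i) (w i)) (trans (cong (v i ⊕_) (⊕-self (w i))) (⊕-identityʳ (v i)))

sumF-cong : ∀ {n} {f g : Fin n → GF4} → f ≗ g → sumF f ≡ sumF g
sumF-cong {zero}  e = refl
sumF-cong {suc n} e = cong₂ _⊕_ (e zero) (sumF-cong (e ∘ suc))

sumF-zero : ∀ {n} {f : Fin n → GF4} → f ≗ 0ᵥ → sumF f ≡ 𝟘
sumF-zero {zero}  e = refl
sumF-zero {suc n} e = cong₂ _⊕_ (e zero) (sumF-zero (e ∘ suc))

sumF-⊕ : ∀ {n} (f g : Fin n → GF4) → sumF (f +ᵥ g) ≡ sumF f ⊕ sumF g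
sumF-⊕ {zero}  f g = refl
sumF-⊕ {suc n} f g = begin
  (f zero ⊕ g zero) ⊕ sumF (tail (f +ᵥ g))          ≡⟨ cong ((f zero ⊕ g zero) ⊕_) (sumF-⊕ (tail f) (tail g)) ⟩
  (f zero ⊕ g zero) ⊕ (sumF (tail f) ⊕ sumF (tail g)) ≡⟨ interchange (f zero) (g zero) _ _ ⟩
  (f zero ⊕ sumF (tail f)) ⊕ (g zero ⊕ sumF (tail g)) ∎
  where
  open ≡-Reasoning
  interchange : ∀ a b c d → (a ⊕ b) ⊕ (c ⊕ d) ≡ (a ⊕ c) ⊕ (b ⊕ d)
  interchange = from-yes (all? λ a → all? λ b → all? λ c → all? λ d → (a ⊕ b) ⊕ (c ⊕ d) ≟ (a ⊕ c) ⊕ (b ⊕ d))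

sumF-⊗ : ∀ {n} c (f : Fin n → GF4) → sumF (c ·ᵥ f) ≡ c ⊗ sumF f
sumF-⊗ {zero}  c f = sym (⊗-zeroʳ c)
sumF-⊗ {suc n} c f = trans (cong (c ⊗ f zero ⊕_) (sumF-⊗ c (tail f))) (sym (⊗-distribˡ-⊕ c (f zero) _))

sumF-inv : ∀ {n} (f : Fin n → GF4) → inv (sumF f) ≡ sumF (inv ∘ f)
sumF-inv {zero}  f = refl
sumF-inv {suc n} f = trans (inv-⊕ (f zero) _) (cong (inv (f zero) ⊕_) (sumF-inv (tail f)))

sumF-single : ∀ {n} (f : Fin n → GF4) i → (∀ j → j ≢ i → f j ≡ 𝟘) → sumF f ≡ f i
sumF-single f zero    off = trans (cong (f zero ⊕_) (sumF-zero (λ j → off (suc j) λ ()))) (⊕-identityʳ (f zero))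
sumF-single f (suc i) off =
  cong₂ _⊕_ (off zero λ ()) (sumF-single (tail f) i λ j j≢i → off (suc j) (j≢i ∘ Finₚ.suc-injective))

sumᵥ : ∀ {n k} → (Fin k → Vect n) → Vect n
sumᵥ F i = sumF (λ j → F j i)

⟨_,_⟩ : ∀ {n} → Vect n → Vect n → GF4
⟨ u , v ⟩ = sumF (λ i → u i ⊗ inv (v i))

⟨⟩-cong : ∀ {n} {u u′ v v′ : Vect n} → u ≗ u′ → v ≗ v′ → ⟨ u , v ⟩ ≡ ⟨ u′ , v′ ⟩
⟨⟩-cong {n} eu ev = sumF-cong {n} (λ i → cong₂ (λ a b → a ⊗ inv b) (eu i) (ev i))

⟨⟩-congˡ : ∀ {n} {u u′ : Vect n} (v : Vect n) → u ≗ u′ → ⟨ u , v ⟩ ≡ ⟨ u′ , v ⟩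
⟨⟩-congˡ v eu = ⟨⟩-cong eu (λ _ → refl)

⟨⟩-congʳ : ∀ {n} (u : Vect n) {v v′ : Vect n} → v ≗ v′ → ⟨ u , v ⟩ ≡ ⟨ u , v′ ⟩
⟨⟩-congʳ u = ⟨⟩-cong (λ _ → refl)

⟨⟩-+ˡ : ∀ {n} (u u′ v : Vect n) → ⟨ u +ᵥ u′ , v ⟩ ≡ ⟨ u , v ⟩ ⊕ ⟨ u′ , v ⟩
⟨⟩-+ˡ {n} u u′ v = trans (sumF-cong {n} (λ i → ⊗-distribʳ-⊕ (inv (v i)) (u i) (u′ i))) (sumF-⊕ {n} _ _)

⟨⟩-+ʳ : ∀ {n} (u v v′ : Vect n) → ⟨ u , v +ᵥ v′ ⟩ ≡ ⟨ u , v ⟩ ⊕ ⟨ u , v′ ⟩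
⟨⟩-+ʳ {n} u v v′ =
  trans (sumF-cong {n} (λ i → trans (cong (u i ⊗_) (inv-⊕ (v i) (v′ i))) (⊗-distribˡ-⊕ (u i) _ _)))
        (sumF-⊕ {n} _ _)

⟨⟩-·ˡ : ∀ {n} c (u v : Vect n) → ⟨ c ·ᵥ u , v ⟩ ≡ c ⊗ ⟨ u , v ⟩
⟨⟩-·ˡ {n} c u v = trans (sumF-cong {n} (λ i → ⊗-assoc c (u i) _)) (sumF-⊗ {n} c _)

⟨⟩-·ʳ : ∀ {n} c (u v : Vect n) → ⟨ u , c ·ᵥ v ⟩ ≡ inv c ⊗ ⟨ u , v ⟩
⟨⟩-·ʳ {n} c u v = trans (sumF-cong {n} (λ i → rearrange c (u i) (v i))) (sumF-⊗ {n} (inv c) _)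
  where
  rearrange : ∀ c a b → a ⊗ inv (c ⊗ b) ≡ inv c ⊗ (a ⊗ inv b)
  rearrange = from-yes (all? λ c → all? λ a → all? λ b → a ⊗ inv (c ⊗ b) ≟ inv c ⊗ (a ⊗ inv b))

⟨⟩-sym : ∀ {n} (u v : Vect n) → ⟨ v , u ⟩ ≡ inv ⟨ u , v ⟩
⟨⟩-sym {n} u v = trans (sumF-cong {n} (λ i → conj (u i) (v i))) (sym (sumF-inv {n} _))
  where
  conj : ∀ a b → b ⊗ inv a ≡ inv (a ⊗ inv b)
  conj = from-yes (all? λ a → all? λ b → b ⊗ inv a ≟ inv (a ⊗ inv b))

⟨⟩-zeroˡ : ∀ {n} (v : Vect n) → ⟨ 0ᵥ , v ⟩ ≡ 𝟘
⟨⟩-zeroˡ {n} v = sumF-zero {n} (λ _ → refl)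

⟨⟩-zeroʳ : ∀ {n} (u : Vect n) → ⟨ u , 0ᵥ ⟩ ≡ 𝟘
⟨⟩-zeroʳ {n} u = sumF-zero {n} (λ i → ⊗-zeroʳ (u i))

⟨⟩-self : ∀ {n} (u : Vect n) → ⟨ u , u ⟩ ≡ 𝟘 ⊎ ⟨ u , u ⟩ ≡ 𝟙
⟨⟩-self u = inv-fixed _ (sym (⟨⟩-sym u u))

unit : ∀ {n} → Fin n → Vect n
unit j i with j Finₚ.≟ i
... | yes _ = 𝟙
... | no  _ = 𝟘

unit-diag : ∀ {n} (j : Fin n) → unit j j ≡ 𝟙
unit-diag j with j Finₚ.≟ j
... | yes _  = refl
... | no j≢j = contradiction refl j≢j

unit-off : ∀ {n} {j i : Fin n} → i ≢ j → unit j i ≡ 𝟘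
unit-off {j = j} {i} i≢j with j Finₚ.≟ i
... | yes j≡i = contradiction (sym j≡i) i≢j
... | no  _   = refl

⟨⟩-unit : ∀ {n} (w : Vect n) j → ⟨ w , unit j ⟩ ≡ w j
⟨⟩-unit w j = trans (sumF-single _ j off) (trans (cong (λ x → w j ⊗ inv x) (unit-diag j)) (⊗-identityʳ (w j)))
  where
  off : ∀ i → i ≢ j → w i ⊗ inv (unit j i) ≡ 𝟘
  off i i≢j = trans (cong (λ x → w i ⊗ inv x) (unit-off i≢j)) (⊗-zeroʳ (w i))

Extensional : ∀ {n} → (Vect n → Set) → Set
Extensional P = ∀ {v w} → v ≗ w → P v → P w

encode : ∀ {n} → Vect n → Fin (4 ^ n)
encode v = funToFin (toFin ∘ v)

decode : ∀ {n} → Fin (4 ^ n) → Vect n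
decode k = fromFin ∘ finToFun k

funToFin-cong : ∀ {m n} {f g : Fin m → Fin n} → f ≗ g → funToFin f ≡ funToFin g
funToFin-cong {zero}  e = refl
funToFin-cong {suc m} e = cong₂ combine (e zero) (funToFin-cong (e ∘ suc))

decode-encode : ∀ {n} (v : Vect n) → decode (encode v) ≗ v
decode-encode v i = trans (cong fromFin (Finₚ.finToFun-funToFin (toFin ∘ v) i)) (fromFin-toFin (v i))

encode-decode : ∀ {n} (k : Fin (4 ^ n)) → encode (decode {n} k) ≡ k
encode-decode {n} k = trans (funToFin-cong {n} (toFin-fromFin ∘ finToFun k)) (Finₚ.funToFin-finToFin {n} k)

encode-cong : ∀ {n} {v w : Vect n} → v ≗ w → encode v ≡ encode w
encode-cong e = funToFin-cong (cong toFin ∘ e)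

encode-injective : ∀ {n} {v w : Vect n} → encode v ≡ encode w → v ≗ w
encode-injective {v = v} {w} e i =
  trans (sym (decode-encode v i)) (trans (cong (λ k → decode k i) e) (decode-encode w i))

module _ {n} {P : Vect n → Set} (P-resp : Extensional P) (P? : ∀ v → Dec (P v)) where

  private
    onCodes : (∀ k → P (decode k)) → ∀ v → P v
    onCodes h v = P-resp (decode-encode v) (h (encode v))

  opaque
    all?ᵥ : Dec (∀ v → P v)
    all?ᵥ = map′ onCodes (λ h k → h (decode k)) (Finₚ.all? (P? ∘ decode))

    ¬∀⇒∃¬ᵥ : ¬ (∀ v → P v) → ∃[ v ] ¬ P v
    ¬∀⇒∃¬ᵥ ¬∀ with k , ¬p ← Finₚ.¬∀⟶∃¬ _ _ (P? ∘ decode) (¬∀ ∘ onCodes) = decode k , ¬p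

injective⇒surjective : ∀ {N} (f : Fin N → Fin N) → (∀ {a b} → f a ≡ f b → a ≡ b) → ∀ t → ∃[ a ] f a ≡ t
injective⇒surjective {suc N} f f-injective t with Finₚ.any? (λ a → f a Finₚ.≟ t)
... | yes found = found
... | no ∄ = contradiction (Finₚ.injective⇒≤ g-injective) ℕₚ.1+n≰n
  where
  t≢f : ∀ a → t ≢ f a
  t≢f a e = ∄ (a , sym e)
  g : Fin (suc N) → Fin N
  g a = punchOut (t≢f a)
  g-injective : ∀ {a b} → g a ≡ g b → a ≡ b
  g-injective e = f-injective (Finₚ.punchOut-injective (t≢f _) (t≢f _) e)

injective⇒surjectiveᵥ : ∀ {n} (Φ : Vect n → Vect n) → (∀ {u v} → Φ u ≗ Φ v → u ≗ v) → ∀ t → ∃[ c ] Φ c ≗ t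
injective⇒surjectiveᵥ {n} Φ Φ-injective t =
  let k , e = injective⇒surjective (encode ∘ Φ ∘ decode) f-injective (encode t) in decode k , encode-injective e
  where
  f-injective : ∀ {a b} → encode (Φ (decode a)) ≡ encode (Φ (decode b)) → a ≡ b
  f-injective {a} {b} e = trans (sym (encode-decode {n} a))
                            (trans (encode-cong (Φ-injective (encode-injective e))) (encode-decode {n} b))

¬→⇒×¬ : ∀ {A B : Set} → Dec A → ¬ (A → B) → A × ¬ B
¬→⇒×¬ (yes a) ¬f = a , λ b → ¬f (λ _ → b)
¬→⇒×¬ (no ¬a) ¬f = contradiction (λ a → contradiction a ¬a) ¬f

j∈X∪⁅j⁆ : ∀ {n} (X : Subset n) j → j ∈ X ∪ ⁅ j ⁆
j∈X∪⁅j⁆ X j = x∈p∪q⁺ (inj₂ (x∈⁅x⁆ j))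

∉-∪⁅⁆ : ∀ {n} {X : Subset n} {i j} → i ≢ j → i ∉ X → i ∉ X ∪ ⁅ j ⁆
∉-∪⁅⁆ {X = X} {j = j} i≢j i∉X i∈ with x∈p∪q⁻ X ⁅ j ⁆ i∈
... | inj₁ i∈X   = i∉X i∈X
... | inj₂ i∈⁅j⁆ = i≢j (x∈⁅y⁆⇒x≡y j i∈⁅j⁆)

∪⁅⁆-⊆ : ∀ {n} {X Y : Subset n} {j} → X ⊆ Y → j ∈ Y → X ∪ ⁅ j ⁆ ⊆ Y
∪⁅⁆-⊆ {X = X} {j = j} X⊆Y j∈Y i∈ with x∈p∪q⁻ X ⁅ j ⁆ i∈
... | inj₁ i∈X   = X⊆Y i∈X
... | inj₂ i∈⁅j⁆ = subst (_∈ _) (sym (x∈⁅y⁆⇒x≡y j i∈⁅j⁆)) j∈Y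

∪⁅⁆-mono : ∀ {n} {X Y : Subset n} j → X ⊆ Y → X ∪ ⁅ j ⁆ ⊆ Y ∪ ⁅ j ⁆
∪⁅⁆-mono {Y = Y} j X⊆Y = ∪⁅⁆-⊆ (⊆-trans X⊆Y (p⊆p∪q _)) (j∈X∪⁅j⁆ Y j)

SupportedIn : ∀ {n} → Vect n → Subset n → Set
SupportedIn v X = ∀ i → i ∉ X → v i ≡ 𝟘

supportedIn? : ∀ {n} (v : Vect n) X → Dec (SupportedIn v X)
supportedIn? v X = Finₚ.all? (λ i → ¬? (i ∈? X) →-dec (v i ≟ 𝟘))

SupportedIn-mono : ∀ {n} {v : Vect n} {X Y} → X ⊆ Y → SupportedIn v X → SupportedIn v Y
SupportedIn-mono X⊆Y s i i∉Y = s i (i∉Y ∘ X⊆Y)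

≗0ᵥ? : ∀ {n} (v : Vect n) → Dec (v ≗ 0ᵥ)
≗0ᵥ? v = Finₚ.all? (λ i → v i ≟ 𝟘)

nonzero-coordinate : ∀ {n} {v : Vect n} → ¬ v ≗ 0ᵥ → ∃[ i ] v i ≢ 𝟘
nonzero-coordinate {n} {v} = Finₚ.¬∀⟶∃¬ n _ (λ i → v i ≟ 𝟘)

record Subspace (n : ℕ) : Set₁ where
  field
    Carrier : Vect n → Set
    _∋?_    : ∀ v → Dec (Carrier v)
    ∋-resp  : Extensional Carrier
    ∋-0ᵥ    : Carrier 0ᵥ
    ∋-+ᵥ    : ∀ {v w} → Carrier v → Carrier w → Carrier (v +ᵥ w)
    ∋-·ᵥ    : ∀ c {v} → Carrier v → Carrier (c ·ᵥ v)

open Subspace public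

infix 4 _∋_
_∋_ : ∀ {n} → Subspace n → Vect n → Set
L ∋ v = Carrier L v

∋-sumᵥ : ∀ {n k} (L : Subspace n) {F : Fin k → Vect n} → (∀ j → L ∋ F j) → L ∋ sumᵥ F
∋-sumᵥ {k = zero}  L F∈ = ∋-0ᵥ L
∋-sumᵥ {k = suc k} L F∈ = ∋-+ᵥ L (F∈ zero) (∋-sumᵥ L (F∈ ∘ suc))

annihilator : ∀ {n} → Vect n → Subspace n
annihilator w = record
  { Carrier = λ t → ⟨ w , t ⟩ ≡ 𝟘
  ; _∋?_    = λ t → ⟨ w , t ⟩ ≟ 𝟘
  ; ∋-resp  = λ e p → trans (⟨⟩-congʳ w (sym ∘ e)) p
  ; ∋-0ᵥ    = ⟨⟩-zeroʳ w
  ; ∋-+ᵥ    = λ {t} {t′} p q → trans (⟨⟩-+ʳ w t t′) (cong₂ _⊕_ p q)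
  ; ∋-·ᵥ    = λ c {t} p → trans (⟨⟩-·ʳ c w t) (trans (cong (inv c ⊗_) p) (⊗-zeroʳ (inv c)))
  }

module _ {n} (L : Subspace n) {R : Vect n → Set} (R-resp : Extensional R) (R? : ∀ v → Dec (R v)) where

  private
    resp : Extensional (λ v → L ∋ v → R v)
    resp e f p = R-resp e (f (∋-resp L (sym ∘ e) p))

    imp? : ∀ v → Dec (L ∋ v → R v)
    imp? v = L ∋? v →-dec R? v

  all∈? : Dec (∀ v → L ∋ v → R v)
  all∈? = all?ᵥ resp imp?

  ¬∀∈⇒∃∈¬ : ¬ (∀ v → L ∋ v → R v) → ∃[ v ] L ∋ v × ¬ R v
  ¬∀∈⇒∃∈¬ ¬∀ with v , ¬imp ← ¬∀⇒∃¬ᵥ resp imp? ¬∀ = v , ¬→⇒×¬ (L ∋? v) ¬imp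

Indep : ∀ {n} → Subspace n → Subset n → Set
Indep L X = ∀ v → L ∋ v → SupportedIn v X → v ≗ 0ᵥ

Basis : ∀ {n} → Subspace n → Subset n → Set
Basis L X = Indep L X × (∀ j → j ∉ X → ¬ Indep L (X ∪ ⁅ j ⁆))

module _ {n} (L : Subspace n) (X : Subset n) where

  private
    resp : Extensional (λ v → SupportedIn v X → v ≗ 0ᵥ)
    resp e f s i = trans (sym (e i)) (f (λ k k∉X → trans (e k) (s k k∉X)) i)

  Indep? : Dec (Indep L X)
  Indep? = all∈? L resp (λ v → supportedIn? v X →-dec ≗0ᵥ? v)

  dependent-vector : ¬ Indep L X → ∃[ v ] L ∋ v × SupportedIn v X × ¬ v ≗ 0ᵥ
  dependent-vector ¬indep with v , v∈L , ¬imp ← ¬∀∈⇒∃∈¬ L resp (λ v → supportedIn? v X →-dec ≗0ᵥ? v) ¬indep =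
    v , v∈L , ¬→⇒×¬ (supportedIn? v X) ¬imp

Basis? : ∀ {n} (L : Subspace n) X → Dec (Basis L X)
Basis? L X = Indep? L X ×-dec Finₚ.all? (λ j → ¬? (j ∈? X) →-dec ¬? (Indep? L (X ∪ ⁅ j ⁆)))

Basis-resp : ∀ {n} (K K′ : Subspace n) → (∀ {v} → K ∋ v → K′ ∋ v) → (∀ {v} → K′ ∋ v → K ∋ v) →
             ∀ {X} → Basis K X → Basis K′ X
Basis-resp K K′ K⊆K′ K′⊆K (indep , max) =
  (λ v v∈K′ → indep v (K′⊆K v∈K′)) , λ j j∉X indep′ → max j j∉X (λ v v∈K → indep′ v (K⊆K′ v∈K))

Indep-anti : ∀ {n} (L : Subspace n) {X Y} → X ⊆ Y → Indep L Y → Indep L X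
Indep-anti L X⊆Y indep v v∈L s = indep v v∈L (SupportedIn-mono X⊆Y s)

Basis-maximal : ∀ {n} (L : Subspace n) {X Y} → Basis L X → Indep L Y → X ⊆ Y → Y ≡ X
Basis-maximal L {X} {Y} (_ , X-max) Y-indep X⊆Y = ⊆-antisym Y⊆X X⊆Y
  where
  Y⊆X : Y ⊆ X
  Y⊆X {i} i∈Y with i ∈? X
  ... | yes i∈X = i∈X
  ... | no  i∉X = contradiction (Indep-anti L (∪⁅⁆-⊆ X⊆Y i∈Y) Y-indep) (X-max i i∉X)

extend-along : ∀ {n} (L : Subspace n) (js : List (Fin n)) {Y} → Indep L Y →
               ∃[ B ] Indep L B × Y ⊆ B × (∀ j → j ∈ₗ js → j ∉ B → ¬ Indep L (B ∪ ⁅ j ⁆))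
extend-along L []       {Y} Y-indep = Y , Y-indep , ⊆-refl , λ _ ()
extend-along L (j ∷ js) {Y} Y-indep with Indep? L (Y ∪ ⁅ j ⁆)
... | yes Yj-indep =
  let B , B-indep , Yj⊆B , B-max = extend-along L js Yj-indep
      B-max′ : ∀ k → k ∈ₗ j ∷ js → k ∉ B → ¬ Indep L (B ∪ ⁅ k ⁆)
      B-max′ = λ { k (hereₗ refl) k∉B _ → k∉B (Yj⊆B (j∈X∪⁅j⁆ Y k)) ; k (thereₗ k∈) → B-max k k∈ }
  in B , B-indep , ⊆-trans (p⊆p∪q _) Yj⊆B , B-max′
... | no ¬Yj-indep =
  let B , B-indep , Y⊆B , B-max = extend-along L js Y-indep
      B-max′ : ∀ k → k ∈ₗ j ∷ js → k ∉ B → ¬ Indep L (B ∪ ⁅ k ⁆)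
      B-max′ = λ { k (hereₗ refl) _ Bk-indep → ¬Yj-indep (Indep-anti L (∪⁅⁆-mono k Y⊆B) Bk-indep)
                 ; k (thereₗ k∈) → B-max k k∈ }
  in B , B-indep , Y⊆B , B-max′

extend-to-basis : ∀ {n} (L : Subspace n) {Y} → Indep L Y → ∃[ B ] Basis L B × Y ⊆ B
extend-to-basis {n} L Y-indep with B , B-indep , Y⊆B , B-max ← extend-along L (allFin n) Y-indep =
  B , (B-indep , λ j → B-max j (∈-allFin j)) , Y⊆B

basis-exists : ∀ {n} (L : Subspace n) → ∃ (Basis L)
basis-exists L with B , B-basis , _ ← extend-to-basis L {∅} (λ v _ s i → s i ∉⊥) = B , B-basis

fundamental-vector : ∀ {n} (L : Subspace n) {B j} → Basis L B → j ∉ B →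
                     ∃[ w ] L ∋ w × w j ≡ 𝟙 × (∀ i → i ≢ j → i ∉ B → w i ≡ 𝟘)
fundamental-vector L {B} {j} (B-indep , B-max) j∉B
  with v , v∈L , v-supp , v≢0 ← dependent-vector L (B ∪ ⁅ j ⁆) (B-max j j∉B) =
  (v j ⁻¹ ·ᵥ v) , ∋-·ᵥ L _ v∈L , ⁻¹-inverse (v j) vj≢𝟘 ,
  λ i i≢j i∉B → trans (cong (v j ⁻¹ ⊗_) (v-supp i (∉-∪⁅⁆ i≢j i∉B))) (⊗-zeroʳ _)
  where
  vj≢𝟘 : v j ≢ 𝟘
  vj≢𝟘 vj≡𝟘 = v≢0 (B-indep v v∈L supported-in-B)
    where
    supported-in-B : SupportedIn v B
    supported-in-B i i∉B with i Finₚ.≟ j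
    ... | yes refl = vj≡𝟘
    ... | no  i≢j  = v-supp i (∉-∪⁅⁆ i≢j i∉B)

record FundamentalFamily {n} (L : Subspace n) (B : Subset n) : Set where
  field
    r        : Fin n → Vect n
    r-∈      : ∀ j → L ∋ r j
    r-inside : ∀ {j} → j ∈ B → r j ≗ 0ᵥ
    r-diag   : ∀ {j} → j ∉ B → r j j ≡ 𝟙
    r-off    : ∀ {i j} → i ≢ j → i ∉ B → r j i ≡ 𝟘

basis⇒family : ∀ {n} (L : Subspace n) {B} → Basis L B → FundamentalFamily L B
basis⇒family {n} L {B} B-basis = record
  { r = r ; r-∈ = r-∈ ; r-inside = r-inside ; r-diag = r-diag ; r-off = r-off }
  where
  r : Fin n → Vect n
  r j with j ∈? B
  ... | yes _   = 0ᵥ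
  ... | no  j∉B = proj₁ (fundamental-vector L B-basis j∉B)

  r-∈ : ∀ j → L ∋ r j
  r-∈ j with j ∈? B
  ... | yes _   = ∋-0ᵥ L
  ... | no  j∉B = proj₁ (proj₂ (fundamental-vector L B-basis j∉B))

  r-inside : ∀ {j} → j ∈ B → r j ≗ 0ᵥ
  r-inside {j} j∈B with j ∈? B
  ... | yes _   = λ _ → refl
  ... | no  j∉B = contradiction j∈B j∉B

  r-diag : ∀ {j} → j ∉ B → r j j ≡ 𝟙
  r-diag {j} j∉B with j ∈? B
  ... | yes j∈B = contradiction j∈B j∉B
  ... | no  j∉B = proj₁ (proj₂ (proj₂ (fundamental-vector L B-basis j∉B)))

  r-off : ∀ {i j} → i ≢ j → i ∉ B → r j i ≡ 𝟘
  r-off {i} {j} i≢j i∉B with j ∈? B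
  ... | yes _   = refl
  ... | no  j∉B = proj₂ (proj₂ (proj₂ (fundamental-vector L B-basis j∉B))) i i≢j i∉B

module Coordinates {n} {L : Subspace n} {B} (F : FundamentalFamily L B) where

  open FundamentalFamily F public

  lincomb : Vect n → Vect n
  lincomb x = sumᵥ (λ j → x j ·ᵥ r j)

  lincomb-∈ : (K : Subspace n) → (∀ j → K ∋ r j) → ∀ x → K ∋ lincomb x
  lincomb-∈ K r∈K x = ∋-sumᵥ K (λ j → ∋-·ᵥ K (x j) (r∈K j))

  lincomb-outside : ∀ x {i} → i ∉ B → lincomb x i ≡ x i
  lincomb-outside x {i} i∉B = begin
    lincomb x i     ≡⟨ sumF-single _ i (λ j j≢i → trans (cong (x j ⊗_) (r-off (j≢i ∘ sym) i∉B)) (⊗-zeroʳ (x j))) ⟩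
    x i ⊗ r i i     ≡⟨ cong (x i ⊗_) (r-diag i∉B) ⟩
    x i ⊗ 𝟙         ≡⟨ ⊗-identityʳ (x i) ⟩
    x i             ∎
    where open ≡-Reasoning

  residual-supported : ∀ x → SupportedIn (x +ᵥ lincomb x) B
  residual-supported x i i∉B = trans (cong (x i ⊕_) (lincomb-outside x i∉B)) (⊕-self (x i))

  module _ (B-indep : Indep L B) where

    -- the coordinates of y ∈ L are its entries outside B
    lincomb-self : ∀ y → L ∋ y → y ≗ lincomb y
    lincomb-self y y∈L i = ⊕≡𝟘⇒≡ _ _ (B-indep _ (∋-+ᵥ L y∈L (lincomb-∈ L r-∈ y)) (residual-supported y) i)

    ⊥-family⇒⊥ : ∀ w → (∀ j → ⟨ w , r j ⟩ ≡ 𝟘) → ∀ y → L ∋ y → ⟨ w , y ⟩ ≡ 𝟘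
    ⊥-family⇒⊥ w w⊥r y y∈L = trans (⟨⟩-congʳ w (lincomb-self y y∈L)) (lincomb-∈ (annihilator w) w⊥r y)

    agree-on-family : ∀ u u′ → (∀ j → j ∉ B → ⟨ u , r j ⟩ ≡ ⟨ u′ , r j ⟩) → ∀ y → L ∋ y → ⟨ u , y ⟩ ≡ ⟨ u′ , y ⟩
    agree-on-family u u′ agree y y∈L =
      ⊕≡𝟘⇒≡ _ _ (trans (sym (⟨⟩-+ˡ u u′ y)) (⊥-family⇒⊥ (u +ᵥ u′) sum⊥r y y∈L))
      where
      sum⊥r : ∀ j → ⟨ u +ᵥ u′ , r j ⟩ ≡ 𝟘
      sum⊥r j with j ∈? B
      ... | yes j∈B = trans (⟨⟩-congʳ _ (r-inside j∈B)) (⟨⟩-zeroʳ (u +ᵥ u′))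
      ... | no  j∉B = trans (⟨⟩-+ˡ u u′ (r j)) (≡⇒⊕≡𝟘 (agree j j∉B))

mask : ∀ {n} → Subset n → Vect n → Vect n
mask X v i with i ∈? X
... | yes _ = v i
... | no  _ = 𝟘

mask-∈ : ∀ {n} {X : Subset n} (v : Vect n) {i} → i ∈ X → mask X v i ≡ v i
mask-∈ {X = X} v {i} i∈X with i ∈? X
... | yes _   = refl
... | no  i∉X = contradiction i∈X i∉X

mask-∉ : ∀ {n} {X : Subset n} (v : Vect n) {i} → i ∉ X → mask X v i ≡ 𝟘
mask-∉ {X = X} v {i} i∉X with i ∈? X
... | yes i∈X = contradiction i∈X i∉X
... | no  _   = refl

mask-cong : ∀ {n} (X : Subset n) {v w : Vect n} → v ≗ w → mask X v ≗ mask X w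
mask-cong X {v} {w} e i with i ∈? X
... | yes i∈X = e i
... | no  i∉X = refl

mask-zero : ∀ {n} (X : Subset n) → mask X 0ᵥ ≗ 0ᵥ
mask-zero X i with i ∈? X
... | yes _ = refl
... | no  _ = refl

mask-+ : ∀ {n} (X : Subset n) (v w : Vect n) → mask X (v +ᵥ w) ≗ mask X v +ᵥ mask X w
mask-+ X v w i with i ∈? X
... | yes _ = refl
... | no  _ = refl

mask-· : ∀ {n} (X : Subset n) c (v : Vect n) → mask X (c ·ᵥ v) ≗ c ·ᵥ mask X v
mask-· X c v i with i ∈? X
... | yes _ = refl
... | no  _ = sym (⊗-zeroʳ c)

mask-supported : ∀ {n} {X : Subset n} {v : Vect n} → SupportedIn v X → mask X v ≗ v
mask-supported {X = X} {v} s i with i ∈? X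
... | yes _   = refl
... | no  i∉X = sym (s i i∉X)

-- The radical of the Hermitian form and the Riesz representation

Radical : ∀ {n} → Subspace n → Vect n → Set
Radical L v = L ∋ v × (∀ w → L ∋ w → ⟨ v , w ⟩ ≡ 𝟘)

radical : ∀ {n} → Subspace n → Subspace n
radical L = record
  { Carrier = Radical L
  ; _∋?_    = λ v → L ∋? v ×-dec all∈? L (λ e p → trans (⟨⟩-congʳ v (sym ∘ e)) p) (λ w → ⟨ v , w ⟩ ≟ 𝟘)
  ; ∋-resp  = λ { e (v∈L , v⊥) → ∋-resp L e v∈L , λ w w∈L → trans (⟨⟩-congˡ w (sym ∘ e)) (v⊥ w w∈L) }
  ; ∋-0ᵥ    = ∋-0ᵥ L , λ w _ → ⟨⟩-zeroˡ w
  ; ∋-+ᵥ    = λ { {v} {v′} (v∈L , v⊥) (v′∈L , v′⊥) → ∋-+ᵥ L v∈L v′∈L ,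
                   λ w w∈L → trans (⟨⟩-+ˡ v v′ w) (cong₂ _⊕_ (v⊥ w w∈L) (v′⊥ w w∈L)) }
  ; ∋-·ᵥ    = λ { c {v} (v∈L , v⊥) → ∋-·ᵥ L c v∈L ,
                   λ w w∈L → trans (⟨⟩-·ˡ c v w) (trans (cong (c ⊗_) (v⊥ w w∈L)) (⊗-zeroʳ c)) }
  }

Nondegenerate : ∀ {n} → Subspace n → Set
Nondegenerate L = ∀ v → Radical L v → v ≗ 0ᵥ

nondegenerate? : ∀ {n} (L : Subspace n) → Dec (Nondegenerate L)
nondegenerate? L = all∈? (radical L) (λ e z i → trans (sym (e i)) (z i)) ≗0ᵥ?

riesz : ∀ {n} (L : Subspace n) → Nondegenerate L → ∀ x →
        ∃[ a ] L ∋ a × (∀ y → L ∋ y → ⟨ a , y ⟩ ≡ ⟨ x , y ⟩)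
riesz {n} L nondeg x with B , B-basis ← basis-exists L =
  lincomb c , lincomb-∈ L r-∈ c , agree-on-family B-indep (lincomb c) x agree
  where
  open Coordinates (basis⇒family L B-basis)
  B-indep = proj₁ B-basis

  -- Φ is injective on the finite space GF(4)ⁿ, hence it hits the coordinates of ⟨ x , _ ⟩.
  Φ : Vect n → Vect n
  Φ c j = mask B c j ⊕ ⟨ lincomb c , r j ⟩

  Φ-inside : ∀ c {j} → j ∈ B → Φ c j ≡ c j
  Φ-inside c {j} j∈B = trans (cong₂ _⊕_ (mask-∈ c j∈B) (trans (⟨⟩-congʳ _ (r-inside j∈B)) (⟨⟩-zeroʳ (lincomb c))))
                             (⊕-identityʳ (c j))

  Φ-outside : ∀ c j → j ∉ B → Φ c j ≡ ⟨ lincomb c , r j ⟩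
  Φ-outside c j j∉B = cong (_⊕ ⟨ lincomb c , r j ⟩) (mask-∉ c j∉B)

  Φ-injective : ∀ {c c′} → Φ c ≗ Φ c′ → c ≗ c′
  Φ-injective {c} {c′} e j with j ∈? B
  ... | yes j∈B = trans (sym (Φ-inside c j∈B)) (trans (e j) (Φ-inside c′ j∈B))
  ... | no  j∉B = trans (sym (lincomb-outside c j∉B)) (trans (⊕≡𝟘⇒≡ _ _ (g≗0 j)) (lincomb-outside c′ j∉B))
    where
    g = lincomb c +ᵥ lincomb c′
    g⊥L : ∀ y → L ∋ y → ⟨ g , y ⟩ ≡ 𝟘
    g⊥L y y∈L = trans (⟨⟩-+ˡ _ _ y) (≡⇒⊕≡𝟘 (agree-on-family B-indep (lincomb c) (lincomb c′)
      (λ k k∉B → trans (sym (Φ-outside c k k∉B)) (trans (e k) (Φ-outside c′ k k∉B))) y y∈L))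
    g≗0 : g ≗ 0ᵥ
    g≗0 = nondeg g (∋-+ᵥ L (lincomb-∈ L r-∈ c) (lincomb-∈ L r-∈ c′) , g⊥L)

  solution = injective⇒surjectiveᵥ Φ Φ-injective (λ j → ⟨ x , r j ⟩)
  c = proj₁ solution

  agree : ∀ j → j ∉ B → ⟨ lincomb c , r j ⟩ ≡ ⟨ x , r j ⟩
  agree j j∉B = trans (sym (Φ-outside c j j∉B)) (proj₂ solution j)

∷ᶠ-cong : ∀ {n} {a b} {v w : Vect n} → a ≡ b → v ≗ w → a ∷ᶠ v ≗ b ∷ᶠ w
∷ᶠ-cong e _ zero    = e
∷ᶠ-cong _ e (suc i) = e i

∷ᶠ-+ᵥ : ∀ {n} a b (v w : Vect n) → (a ∷ᶠ v) +ᵥ (b ∷ᶠ w) ≗ (a ⊕ b) ∷ᶠ (v +ᵥ w)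
∷ᶠ-+ᵥ a b v w zero    = refl
∷ᶠ-+ᵥ a b v w (suc i) = refl

∷ᶠ-·ᵥ : ∀ {n} c a (v : Vect n) → c ·ᵥ (a ∷ᶠ v) ≗ (c ⊗ a) ∷ᶠ (c ·ᵥ v)
∷ᶠ-·ᵥ c a v zero    = refl
∷ᶠ-·ᵥ c a v (suc i) = refl

head-tail : ∀ {n} (v : Vect (suc n)) → v ≗ v zero ∷ᶠ tail v
head-tail v zero    = refl
head-tail v (suc i) = refl

≗0ᵥ-∷ : ∀ {n} {v : Vect (suc n)} → v zero ≡ 𝟘 → tail v ≗ 0ᵥ → v ≗ 0ᵥ
≗0ᵥ-∷ v₀≡𝟘 _ zero    = v₀≡𝟘
≗0ᵥ-∷ _ tail≗0 (suc i) = tail≗0 i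

⟨⟩-𝟘∷ : ∀ {n} (s : Vect (suc n)) (y : Vect n) → ⟨ s , 𝟘 ∷ᶠ y ⟩ ≡ ⟨ tail s , y ⟩
⟨⟩-𝟘∷ s y = cong (_⊕ ⟨ tail s , y ⟩) (⊗-zeroʳ (s zero))

SupportedIn-tail : ∀ {n} {v : Vect (suc n)} {b X} → SupportedIn v (b ∷ X) → SupportedIn (tail v) X
SupportedIn-tail s k k∉X = s (suc k) (k∉X ∘ drop-there)

SupportedIn-∷ : ∀ {n} {a} {v : Vect n} {b X} → (zero ∉ b ∷ X → a ≡ 𝟘) → SupportedIn v X →
                SupportedIn (a ∷ᶠ v) (b ∷ X)
SupportedIn-∷ a≡𝟘 s zero    z∉  = a≡𝟘 z∉
SupportedIn-∷ a≡𝟘 s (suc k) sk∉ = s k (drop-not-there sk∉)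

-- delete₀ L and contract₀ L represent the deletion M(L) ∖ 0 and the contraction M(L) / 0
module _ {n} (L : Subspace (suc n)) where

  delete₀ : Subspace n
  delete₀ = record
    { Carrier = λ v → L ∋ 𝟘 ∷ᶠ v
    ; _∋?_    = λ v → L ∋? (𝟘 ∷ᶠ v)
    ; ∋-resp  = λ e → ∋-resp L (∷ᶠ-cong refl e)
    ; ∋-0ᵥ    = ∋-resp L (∷ᶠ-cong refl (λ _ → refl)) (∋-resp L (head-tail 0ᵥ) (∋-0ᵥ L))
    ; ∋-+ᵥ    = λ {v} {w} p q → ∋-resp L (∷ᶠ-+ᵥ 𝟘 𝟘 v w) (∋-+ᵥ L p q)
    ; ∋-·ᵥ    = λ c {v} p → ∋-resp L (λ i → trans (∷ᶠ-·ᵥ c 𝟘 v i) (∷ᶠ-cong (⊗-zeroʳ c) (λ _ → refl) i))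
                                      (∋-·ᵥ L c p)
    }

  contract₀ : Subspace n
  contract₀ = record
    { Carrier = λ v → ∃[ c ] L ∋ c ∷ᶠ v
    ; _∋?_    = λ v → any? (λ c → L ∋? (c ∷ᶠ v))
    ; ∋-resp  = λ { e (c , p) → c , ∋-resp L (∷ᶠ-cong refl e) p }
    ; ∋-0ᵥ    = 𝟘 , ∋-resp L (head-tail 0ᵥ) (∋-0ᵥ L)
    ; ∋-+ᵥ    = λ { {v} {w} (c , p) (c′ , q) → c ⊕ c′ , ∋-resp L (∷ᶠ-+ᵥ c c′ v w) (∋-+ᵥ L p q) }
    ; ∋-·ᵥ    = λ { k {v} (c , p) → k ⊗ c , ∋-resp L (∷ᶠ-·ᵥ k c v) (∋-·ᵥ L k p) }
    }

  Loop : Set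
  Loop = L ∋ 𝟙 ∷ᶠ 0ᵥ

  Coloop : Set
  Coloop = ∀ v → L ∋ v → v zero ≡ 𝟘

  coloop? : Dec Coloop
  coloop? = all∈? L (λ e p → trans (sym (e zero)) p) (λ v → v zero ≟ 𝟘)

  ¬coloop⇒head-𝟙 : ¬ Coloop → ∃[ u ] L ∋ u × u zero ≡ 𝟙
  ¬coloop⇒head-𝟙 ¬coloop
    with u , u∈L , u₀≢𝟘 ← ¬∀∈⇒∃∈¬ L (λ e p → trans (sym (e zero)) p) (λ v → v zero ≟ 𝟘) ¬coloop =
    u zero ⁻¹ ·ᵥ u , ∋-·ᵥ L _ u∈L , ⁻¹-inverse (u zero) u₀≢𝟘

  tail-∈-delete : ∀ {v} → L ∋ v → v zero ≡ 𝟘 → delete₀ ∋ tail v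
  tail-∈-delete {v} v∈L v₀≡𝟘 = ∋-resp L (λ i → trans (head-tail v i) (∷ᶠ-cong v₀≡𝟘 (λ _ → refl) i)) v∈L

  tail-∈-contract : ∀ {v} → L ∋ v → contract₀ ∋ tail v
  tail-∈-contract {v} v∈L = v zero , ∋-resp L (head-tail v) v∈L

  loop-free : ¬ Loop → ∀ {v} → L ∋ v → tail v ≗ 0ᵥ → v zero ≡ 𝟘
  loop-free ¬loop {v} v∈L tail≗0 with v zero ≟ 𝟘
  ... | yes v₀≡𝟘 = v₀≡𝟘
  ... | no  v₀≢𝟘 = contradiction (∋-resp L normalise (∋-·ᵥ L (v zero ⁻¹) v∈L)) ¬loop
    where
    normalise : v zero ⁻¹ ·ᵥ v ≗ 𝟙 ∷ᶠ 0ᵥ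
    normalise zero    = ⁻¹-inverse (v zero) v₀≢𝟘
    normalise (suc i) = trans (cong (v zero ⁻¹ ⊗_) (tail≗0 i)) (⊗-zeroʳ _)

  Indep-delete⇒ : ∀ {X} → Indep L (outside ∷ X) → Indep delete₀ X
  Indep-delete⇒ indep v v∈D s i = indep (𝟘 ∷ᶠ v) v∈D (SupportedIn-∷ (λ _ → refl) s) (suc i)

  Indep-delete⇐ : ∀ {X} → Indep delete₀ X → Indep L (outside ∷ X)
  Indep-delete⇐ indep v v∈L s = ≗0ᵥ-∷ v₀≡𝟘 (indep (tail v) (tail-∈-delete v∈L v₀≡𝟘) (SupportedIn-tail s))
    where v₀≡𝟘 = s zero λ ()

  Indep-contract⇒ : ∀ {X} → Indep L (inside ∷ X) → Indep contract₀ X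
  Indep-contract⇒ indep v (c , cv∈L) s i = indep (c ∷ᶠ v) cv∈L (SupportedIn-∷ (contradiction here) s) (suc i)

  Indep-contract⇐ : ¬ Loop → ∀ {X} → Indep contract₀ X → Indep L (inside ∷ X)
  Indep-contract⇐ ¬loop indep v v∈L s = ≗0ᵥ-∷ (loop-free ¬loop v∈L tail≗0) tail≗0
    where tail≗0 = indep (tail v) (tail-∈-contract v∈L) (SupportedIn-tail s)

  loop-dependent : Loop → ∀ {X} → ¬ Indep L (inside ∷ X)
  loop-dependent loop indep with () ← indep (𝟙 ∷ᶠ 0ᵥ) loop (SupportedIn-∷ (contradiction here) (λ _ _ → refl)) zero

  Indep-coloop : Coloop → ∀ {X} → Indep L (outside ∷ X) → Indep L (inside ∷ X)
  Indep-coloop coloop indep v v∈L s = indep v v∈L λ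
    { zero    _   → coloop v v∈L
    ; (suc k) sk∉ → s (suc k) (sk∉ ∘ there ∘ drop-there) }

  Basis-contract⇒ : ¬ Loop → ∀ {X} → Basis L (inside ∷ X) → Basis contract₀ X
  Basis-contract⇒ ¬loop (indep , max) =
    Indep-contract⇒ indep , λ j j∉X indep′ → max (suc j) (j∉X ∘ drop-there) (Indep-contract⇐ ¬loop indep′)

  Basis-contract⇐ : ¬ Loop → ∀ {X} → Basis contract₀ X → Basis L (inside ∷ X)
  Basis-contract⇐ ¬loop (indep , max) = Indep-contract⇐ ¬loop indep , λ
    { zero    z∉  _       → z∉ here
    ; (suc j) sj∉ indep′ → max j (drop-not-there sj∉) (Indep-contract⇒ indep′) }

  Basis-delete⇒ : ∀ {X} → Basis L (outside ∷ X) → Basis delete₀ X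
  Basis-delete⇒ (indep , max) =
    Indep-delete⇒ indep , λ j j∉X indep′ → max (suc j) (j∉X ∘ drop-there) (Indep-delete⇐ indep′)

  Basis-delete⇐ : ∀ {X} → ¬ Indep L (inside ∷ X) → Basis delete₀ X → Basis L (outside ∷ X)
  Basis-delete⇐ {X} dependent (indep , max) = Indep-delete⇐ indep , λ
    { zero    _   indep′ → dependent (subst (λ Y → Indep L (inside ∷ Y)) (∪-identityʳ X) indep′)
    ; (suc j) sj∉ indep′ → max j (drop-not-there sj∉) (Indep-delete⇒ indep′) }

  coloop⇒¬loop : Coloop → ¬ Loop
  coloop⇒¬loop coloop loop with () ← coloop _ loop

  Basis-coloop-outside : Coloop → ∀ {X} → ¬ Basis L (outside ∷ X)
  Basis-coloop-outside coloop {X} (indep , max) =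
    max zero (λ ()) (subst (λ Y → Indep L (inside ∷ Y)) (sym (∪-identityʳ X)) (Indep-coloop coloop indep))

  coloop⇒contract⊆delete : Coloop → ∀ {v} → contract₀ ∋ v → delete₀ ∋ v
  coloop⇒contract⊆delete coloop (c , cv∈L) = subst (λ c → L ∋ c ∷ᶠ _) (coloop _ cv∈L) cv∈L

  Basis-coloop⇒ : Coloop → ∀ {X} → Basis L (inside ∷ X) → Basis delete₀ X
  Basis-coloop⇒ coloop X-basis = Basis-resp contract₀ delete₀ (coloop⇒contract⊆delete coloop) (𝟘 ,_)
                                   (Basis-contract⇒ (coloop⇒¬loop coloop) X-basis)

  Basis-coloop⇐ : Coloop → ∀ {X} → Basis delete₀ X → Basis L (inside ∷ X)
  Basis-coloop⇐ coloop X-basis = Basis-contract⇐ (coloop⇒¬loop coloop)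
                                   (Basis-resp delete₀ contract₀ (𝟘 ,_) (coloop⇒contract⊆delete coloop) X-basis)

  -- reduce a vector with head 𝟙 by the fundamental family of a basis of the deletion
  head-𝟙⇒dependent : ∀ {u} → L ∋ u → u zero ≡ 𝟙 → ∀ {X} → Basis delete₀ X → ¬ Indep L (inside ∷ X)
  head-𝟙⇒dependent {u} u∈L u₀≡𝟙 X-basis indep =
    contradiction (trans (sym w₀≡𝟙) (indep w w∈L w-supported zero)) λ ()
    where
    open Coordinates (basis⇒family delete₀ X-basis)
    w = u +ᵥ (𝟘 ∷ᶠ lincomb (tail u))
    w∈L : L ∋ w
    w∈L = ∋-+ᵥ L u∈L (lincomb-∈ delete₀ r-∈ (tail u))
    w₀≡𝟙 : w zero ≡ 𝟙
    w₀≡𝟙 = trans (⊕-identityʳ (u zero)) u₀≡𝟙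
    w-supported : SupportedIn w (inside ∷ _)
    w-supported zero    z∉  = contradiction here z∉
    w-supported (suc k) sk∉ = residual-supported (tail u) k (drop-not-there sk∉)

-- Nondegeneracy of the minors

module _ {n} (L : Subspace (suc n)) where

  private
    D = delete₀ L
    C = contract₀ L

  ⟨⟩-decompose : ∀ {z} → L ∋ z → z zero ≡ 𝟙 → ∀ s {w} → L ∋ w →
                 ∃[ y ] D ∋ y × ⟨ s , w ⟩ ≡ ⟨ tail s , y ⟩ ⊕ inv (w zero) ⊗ ⟨ s , z ⟩
  ⟨⟩-decompose {z} z∈L z₀≡𝟙 s {w} w∈L = y , y∈D , (begin
    ⟨ s , w ⟩                                  ≡⟨ ⟨⟩-congʳ s split ⟩
    ⟨ s , (𝟘 ∷ᶠ y) +ᵥ w zero ·ᵥ z ⟩           ≡⟨ ⟨⟩-+ʳ s (𝟘 ∷ᶠ y) (w zero ·ᵥ z) ⟩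
    ⟨ s , 𝟘 ∷ᶠ y ⟩ ⊕ ⟨ s , w zero ·ᵥ z ⟩      ≡⟨ cong₂ _⊕_ (⟨⟩-𝟘∷ s y) (⟨⟩-·ʳ (w zero) s z) ⟩
    ⟨ tail s , y ⟩ ⊕ inv (w zero) ⊗ ⟨ s , z ⟩ ∎)
    where
    open ≡-Reasoning
    w₀z₀≡w₀ : w zero ⊗ z zero ≡ w zero
    w₀z₀≡w₀ = trans (cong (w zero ⊗_) z₀≡𝟙) (⊗-identityʳ (w zero))
    x = w +ᵥ w zero ·ᵥ z
    y = tail x
    y∈D : D ∋ y
    y∈D = tail-∈-delete L {x} (∋-+ᵥ L w∈L (∋-·ᵥ L (w zero) z∈L))
                              (trans (cong (w zero ⊕_) w₀z₀≡w₀) (⊕-self (w zero)))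
    split : w ≗ (𝟘 ∷ᶠ y) +ᵥ w zero ·ᵥ z
    split zero    = sym w₀z₀≡w₀
    split (suc i) = sym (+ᵥ-cancelʳ w (w zero ·ᵥ z) (suc i))

  zero-head-radical : Nondegenerate D → ∀ {s} → Radical L s → s zero ≡ 𝟘 → s ≗ 0ᵥ
  zero-head-radical nondeg {s} (s∈L , s⊥) s₀≡𝟘 =
    ≗0ᵥ-∷ s₀≡𝟘 (nondeg (tail s) (tail-∈-delete L s∈L s₀≡𝟘 , λ y y∈D → trans (sym (⟨⟩-𝟘∷ s y)) (s⊥ _ y∈D)))

  nondegenerate-loop : Loop L → Nondegenerate L ⇔ Nondegenerate D
  nondegenerate-loop loop = mk⇔ to from
    where
    to : Nondegenerate L → Nondegenerate D
    to nondeg v (v∈D , v⊥) i = nondeg (𝟘 ∷ᶠ v) (v∈D , ⊥L) (suc i)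
      where
      ⊥L : ∀ w → L ∋ w → ⟨ 𝟘 ∷ᶠ v , w ⟩ ≡ 𝟘
      ⊥L w w∈L with y , y∈D , eq ← ⟨⟩-decompose loop refl (𝟘 ∷ᶠ v) w∈L =
        trans eq (cong₂ _⊕_ (v⊥ y y∈D) (trans (cong (inv (w zero) ⊗_) (⟨⟩-zeroʳ v)) (⊗-zeroʳ _)))

    from : Nondegenerate D → Nondegenerate L
    from nondeg s s-rad@(s∈L , s⊥) = zero-head-radical nondeg s-rad s₀≡𝟘
      where
      s₀≡𝟘 : s zero ≡ 𝟘
      s₀≡𝟘 = trans (sym (trans (cong₂ _⊕_ (⊗-identityʳ (s zero)) (⟨⟩-zeroʳ (tail s))) (⊕-identityʳ _))) (s⊥ _ loop)

  nondegenerate-coloop : Coloop L → Nondegenerate L ⇔ Nondegenerate D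
  nondegenerate-coloop coloop = mk⇔ to from
    where
    to : Nondegenerate L → Nondegenerate D
    to nondeg v (v∈D , v⊥) i =
      nondeg (𝟘 ∷ᶠ v) (v∈D , λ w w∈L → v⊥ (tail w) (tail-∈-delete L w∈L (coloop w w∈L))) (suc i)

    from : Nondegenerate D → Nondegenerate L
    from nondeg s s-rad = zero-head-radical nondeg s-rad (coloop s (proj₁ s-rad))

  -- a radical vector s with s₀ = 𝟙 forces every c ∷ t ∈ L with t ∈ rad C to be a multiple of s
  radical-head-𝟙⇒nondegenerate : Nondegenerate D → ∀ {s} → Radical L s → s zero ≡ 𝟙 → Nondegenerate C
  radical-head-𝟙⇒nondegenerate nondeg {s} (s∈L , s⊥) s₀≡𝟙 t ((c , ct∈L) , t⊥) i = ct≗0 (suc i)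
    where
    ct = c ∷ᶠ t
    x = ct +ᵥ c ·ᵥ s
    x∈L : L ∋ x
    x∈L = ∋-+ᵥ L ct∈L (∋-·ᵥ L c s∈L)
    x₀≡𝟘 : x zero ≡ 𝟘
    x₀≡𝟘 = trans (cong (λ a → c ⊕ c ⊗ a) s₀≡𝟙) (trans (cong (c ⊕_) (⊗-identityʳ c)) (⊕-self c))
    tail-x⊥D : ∀ y → D ∋ y → ⟨ tail x , y ⟩ ≡ 𝟘
    tail-x⊥D y y∈D = begin
      ⟨ tail x , y ⟩                       ≡⟨ ⟨⟩-𝟘∷ x y ⟨
      ⟨ x , 𝟘 ∷ᶠ y ⟩                       ≡⟨ ⟨⟩-+ˡ ct (c ·ᵥ s) (𝟘 ∷ᶠ y) ⟩
      ⟨ ct , 𝟘 ∷ᶠ y ⟩ ⊕ ⟨ c ·ᵥ s , 𝟘 ∷ᶠ y ⟩ ≡⟨ cong₂ _⊕_ (trans (⟨⟩-𝟘∷ ct y) (t⊥ y (𝟘 , y∈D)))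
                                                         (⟨⟩-·ˡ c s (𝟘 ∷ᶠ y)) ⟩
      𝟘 ⊕ c ⊗ ⟨ s , 𝟘 ∷ᶠ y ⟩               ≡⟨ cong (c ⊗_) (s⊥ _ y∈D) ⟩
      c ⊗ 𝟘                                ≡⟨ ⊗-zeroʳ c ⟩
      𝟘                                    ∎
      where open ≡-Reasoning
    ct≗cs : ct ≗ c ·ᵥ s
    ct≗cs i = ⊕≡𝟘⇒≡ _ _ (≗0ᵥ-∷ {v = x} x₀≡𝟘 (nondeg (tail x) (tail-∈-delete L {x} x∈L x₀≡𝟘 , tail-x⊥D)) i)
    c≡𝟘 : c ≡ 𝟘
    c≡𝟘 = norm≡𝟘⇒≡𝟘 c (begin
      c ⊗ inv c                     ≡⟨ ⊕-identityʳ _ ⟨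
      c ⊗ inv c ⊕ 𝟘                 ≡⟨ cong (c ⊗ inv c ⊕_) (t⊥ t (c , ct∈L)) ⟨
      ⟨ ct , ct ⟩                   ≡⟨ ⟨⟩-cong ct≗cs ct≗cs ⟩
      ⟨ c ·ᵥ s , c ·ᵥ s ⟩           ≡⟨ ⟨⟩-·ˡ c s (c ·ᵥ s) ⟩
      c ⊗ ⟨ s , c ·ᵥ s ⟩            ≡⟨ cong (c ⊗_) (⟨⟩-·ʳ c s s) ⟩
      c ⊗ (inv c ⊗ ⟨ s , s ⟩)       ≡⟨ cong (λ a → c ⊗ (inv c ⊗ a)) (s⊥ s s∈L) ⟩
      c ⊗ (inv c ⊗ 𝟘)               ≡⟨ cong (c ⊗_) (⊗-zeroʳ (inv c)) ⟩
      c ⊗ 𝟘                         ≡⟨ ⊗-zeroʳ c ⟩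
      𝟘                             ∎)
      where open ≡-Reasoning
    ct≗0 : ct ≗ 0ᵥ
    ct≗0 i = trans (ct≗cs i) (cong (_⊗ s i) c≡𝟘)

  module _ (¬loop : ¬ Loop L) {u} (u∈L : L ∋ u) (u₀≡𝟙 : u zero ≡ 𝟙) where

    nondegenerate-from-delete : Nondegenerate D → ¬ Nondegenerate C → Nondegenerate L
    nondegenerate-from-delete nondeg ¬nondeg-C s s-rad with s zero ≟ 𝟘
    ... | yes s₀≡𝟘 = zero-head-radical nondeg s-rad s₀≡𝟘
    ... | no  s₀≢𝟘 = contradiction (radical-head-𝟙⇒nondegenerate nondeg (∋-·ᵥ (radical L) _ s-rad)
                                      (⁻¹-inverse (s zero) s₀≢𝟘)) ¬nondeg-C

    -- Riesz in D moves u to a z ∈ L whose tail is orthogonal to D; ⟨ z , z ⟩ ∈ {𝟘, 𝟙} then contradicts L or C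
    not-all-nondegenerate : Nondegenerate D → Nondegenerate L → ¬ Nondegenerate C
    not-all-nondegenerate nondeg-D nondeg-L nondeg-C
      with a , a∈D , a-represents ← riesz D nondeg-D (tail u) = contradict (⟨⟩-self z)
      where
      z = u +ᵥ (𝟘 ∷ᶠ a)
      z∈L : L ∋ z
      z∈L = ∋-+ᵥ L u∈L a∈D
      z₀≡𝟙 : z zero ≡ 𝟙
      z₀≡𝟙 = trans (⊕-identityʳ (u zero)) u₀≡𝟙
      z-pairing : ∀ {w} → L ∋ w → ⟨ z , w ⟩ ≡ inv (w zero) ⊗ ⟨ z , z ⟩
      z-pairing w∈L with y , y∈D , eq ← ⟨⟩-decompose z∈L z₀≡𝟙 z w∈L =
        trans eq (cong (_⊕ _) (trans (⟨⟩-+ˡ (tail u) a y) (≡⇒⊕≡𝟘 (sym (a-represents y y∈D)))))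
      contradict : ⟨ z , z ⟩ ≡ 𝟘 ⊎ ⟨ z , z ⟩ ≡ 𝟙 → ⊥
      contradict (inj₁ zz≡𝟘) = contradiction (trans (sym z₀≡𝟙) (nondeg-L z (z∈L , z⊥L) zero)) λ ()
        where
        z⊥L : ∀ w → L ∋ w → ⟨ z , w ⟩ ≡ 𝟘
        z⊥L w w∈L = trans (z-pairing w∈L) (trans (cong (inv (w zero) ⊗_) zz≡𝟘) (⊗-zeroʳ _))
      contradict (inj₂ zz≡𝟙) = contradiction (trans (sym z₀≡𝟙) (loop-free L ¬loop z∈L tail-z≗0)) λ ()
        where
        tail-z⊥C : ∀ w → C ∋ w → ⟨ tail z , w ⟩ ≡ 𝟘
        tail-z⊥C w (c , cw∈L) = ⊕-cancelˡ (inv c) _ (begin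
          inv c ⊕ ⟨ tail z , w ⟩              ≡⟨ cong (λ a → a ⊗ inv c ⊕ ⟨ tail z , w ⟩) z₀≡𝟙 ⟨
          ⟨ z , c ∷ᶠ w ⟩                      ≡⟨ z-pairing cw∈L ⟩
          inv c ⊗ ⟨ z , z ⟩                   ≡⟨ cong (inv c ⊗_) zz≡𝟙 ⟩
          inv c ⊗ 𝟙                           ≡⟨ ⊗-identityʳ (inv c) ⟩
          inv c                               ∎)
          where open ≡-Reasoning
        tail-z≗0 : tail z ≗ 0ᵥ
        tail-z≗0 = nondeg-C (tail z) (tail-∈-contract L z∈L , tail-z⊥C)

    -- a vector r ∈ rad D pairs with every w ∈ L through w₀ alone: ⟨ 𝟘 ∷ r , w ⟩ = inv w₀ · ⟨ 𝟘 ∷ r , u ⟩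
    module _ {r} (r∈D : D ∋ r) (r⊥D : ∀ y → D ∋ y → ⟨ r , y ⟩ ≡ 𝟘) where

      private
        R = 𝟘 ∷ᶠ r
        a = ⟨ R , u ⟩

        R-pairing : ∀ {w} → L ∋ w → ⟨ R , w ⟩ ≡ inv (w zero) ⊗ a
        R-pairing w∈L with y , y∈D , eq ← ⟨⟩-decompose u∈L u₀≡𝟙 R w∈L = trans eq (cong (_⊕ _) (r⊥D y y∈D))

        head-unchanged : ∀ (v : Vect (suc n)) k → (v +ᵥ k ·ᵥ R) zero ≡ v zero
        head-unchanged v k = trans (cong (v zero ⊕_) (⊗-zeroʳ k)) (⊕-identityʳ (v zero))

        tail-unchanged : ∀ (v : Vect (suc n)) c → c ≡ 𝟘 → ∀ i → (v +ᵥ (c ⊗ a ⁻¹) ·ᵥ R) (suc i) ≡ v (suc i)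
        tail-unchanged v c c≡𝟘 i = trans (cong (λ c → v (suc i) ⊕ (c ⊗ a ⁻¹) ⊗ r i) c≡𝟘) (⊕-identityʳ (v (suc i)))

      isotropic⇒radical : a ≡ 𝟘 → Radical L R × Radical C r
      isotropic⇒radical a≡𝟘 = (r∈D , R⊥L) , (𝟘 , r∈D) , λ w (c , cw∈L) → R⊥L (c ∷ᶠ w) cw∈L
        where
        R⊥L : ∀ w → L ∋ w → ⟨ R , w ⟩ ≡ 𝟘
        R⊥L w w∈L = trans (R-pairing w∈L) (trans (cong (inv (w zero) ⊗_) a≡𝟘) (⊗-zeroʳ _))

      anisotropic⇒nondegenerate-C : a ≢ 𝟘 → Nondegenerate L → Nondegenerate C
      anisotropic⇒nondegenerate-C a≢𝟘 nondeg-L t ((c , ct∈L) , t⊥C) i =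
        trans (sym (tail-unchanged ct c c≡𝟘 i)) (x≗0 (suc i))
        where
        ct = c ∷ᶠ t
        k = c ⊗ a ⁻¹
        x = ct +ᵥ k ·ᵥ R
        x⊥L : ∀ w → L ∋ w → ⟨ x , w ⟩ ≡ 𝟘
        x⊥L w w∈L = begin
          ⟨ x , w ⟩                                         ≡⟨ ⟨⟩-+ˡ ct (k ·ᵥ R) w ⟩
          ⟨ ct , w ⟩ ⊕ ⟨ k ·ᵥ R , w ⟩
            ≡⟨ cong₂ _⊕_ (cong (c ⊗ inv (w zero) ⊕_) (t⊥C _ (tail-∈-contract L w∈L)))
                         (trans (⟨⟩-·ˡ k R w) (cong (k ⊗_) (R-pairing w∈L))) ⟩
          (c ⊗ inv (w zero) ⊕ 𝟘) ⊕ k ⊗ (inv (w zero) ⊗ a)   ≡⟨ cong (_⊕ k ⊗ (inv (w zero) ⊗ a)) (⊕-identityʳ _) ⟩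
          c ⊗ inv (w zero) ⊕ k ⊗ (inv (w zero) ⊗ a)         ≡⟨ scaled-cancel a c (inv (w zero)) a≢𝟘 ⟩
          𝟘                                                 ∎
          where open ≡-Reasoning
        x≗0 : x ≗ 0ᵥ
        x≗0 = nondeg-L x (∋-+ᵥ L ct∈L (∋-·ᵥ L k r∈D) , x⊥L)
        c≡𝟘 : c ≡ 𝟘
        c≡𝟘 = trans (sym (head-unchanged ct k)) (x≗0 zero)

      anisotropic⇒nondegenerate-L : a ≢ 𝟘 → Nondegenerate C → Nondegenerate L
      anisotropic⇒nondegenerate-L a≢𝟘 nondeg-C s (s∈L , s⊥L) =
        ≗0ᵥ-∷ s₀≡𝟘 (λ i → trans (sym (tail-unchanged s _ s₀≡𝟘 i)) (tail-x≗0 i))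
        where
        k = s zero ⊗ a ⁻¹
        x = s +ᵥ k ·ᵥ R
        x∈L : L ∋ x
        x∈L = ∋-+ᵥ L s∈L (∋-·ᵥ L k r∈D)
        tail-x⊥C : ∀ w → C ∋ w → ⟨ tail x , w ⟩ ≡ 𝟘
        tail-x⊥C w (c , cw∈L) = begin
          ⟨ tail x , w ⟩                                ≡⟨ ⟨⟩-+ˡ (tail s) (k ·ᵥ r) w ⟩
          ⟨ tail s , w ⟩ ⊕ ⟨ k ·ᵥ r , w ⟩
            ≡⟨ cong₂ _⊕_ (sym (⊕≡𝟘⇒≡ _ _ (s⊥L _ cw∈L))) (trans (⟨⟩-·ˡ k r w) (cong (k ⊗_) (R-pairing cw∈L))) ⟩
          s zero ⊗ inv c ⊕ k ⊗ (inv c ⊗ a)              ≡⟨ scaled-cancel a (s zero) (inv c) a≢𝟘 ⟩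
          𝟘                                             ∎
          where open ≡-Reasoning
        tail-x≗0 : tail x ≗ 0ᵥ
        tail-x≗0 = nondeg-C (tail x) (tail-∈-contract L x∈L , tail-x⊥C)
        s₀≡𝟘 : s zero ≡ 𝟘
        s₀≡𝟘 = trans (sym (head-unchanged s k)) (loop-free L ¬loop x∈L tail-x≗0)

    degenerate-delete⇒nondegenerate⇔ : ¬ Nondegenerate D → Nondegenerate L ⇔ Nondegenerate C
    degenerate-delete⇒nondegenerate⇔ ¬nondeg-D
      with r , (r∈D , r⊥D) , r≢0 ← ¬∀∈⇒∃∈¬ (radical D) (λ e z i → trans (sym (e i)) (z i)) ≗0ᵥ? ¬nondeg-D
      with ⟨ 𝟘 ∷ᶠ r , u ⟩ ≟ 𝟘
    ... | yes a≡𝟘 = mk⇔ (λ nondeg-L → contradiction (λ i → nondeg-L _ R-radical (suc i)) r≢0)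
                        (λ nondeg-C → contradiction (nondeg-C r r-radical) r≢0)
      where
      R-radical = proj₁ (isotropic⇒radical r∈D r⊥D a≡𝟘)
      r-radical = proj₂ (isotropic⇒radical r∈D r⊥D a≡𝟘)
    ... | no  a≢𝟘 = mk⇔ (anisotropic⇒nondegenerate-C r∈D r⊥D a≢𝟘) (anisotropic⇒nondegenerate-L r∈D r⊥D a≢𝟘)

enumerate : ∀ {n} {P : Subset n → Set} → (∀ X → Dec (P X)) → List (Subset n)
enumerate {zero}  P? with P? []
... | yes _ = [] ∷ []
... | no  _ = []
enumerate {suc n} P? = map (inside ∷_) (enumerate (P? ∘ (inside ∷_)))
                    ++ map (outside ∷_) (enumerate (P? ∘ (outside ∷_)))

enumerate-sound : ∀ {n} {P : Subset n → Set} (P? : ∀ X → Dec (P X)) {X} → X ∈ₗ enumerate P? → P X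
enumerate-sound {zero} P? {[]} X∈ with P? []
... | yes p = p
enumerate-sound {suc n} P? X∈ with ∈-++⁻ (map (inside ∷_) (enumerate (P? ∘ (inside ∷_)))) X∈
... | inj₁ X∈ᵢ with _ , Y∈ , refl ← ∈-map⁻ (inside ∷_) X∈ᵢ  = enumerate-sound (P? ∘ (inside ∷_)) Y∈
... | inj₂ X∈ₒ with _ , Y∈ , refl ← ∈-map⁻ (outside ∷_) X∈ₒ = enumerate-sound (P? ∘ (outside ∷_)) Y∈

enumerate-complete : ∀ {n} {P : Subset n → Set} (P? : ∀ X → Dec (P X)) {X} → P X → X ∈ₗ enumerate P?
enumerate-complete {zero} P? {[]} p with P? []
... | yes _  = hereₗ refl
... | no  ¬p = contradiction p ¬p
enumerate-complete {suc n} P? {inside ∷ X} p =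
  ∈-++⁺ˡ (∈-map⁺ (inside ∷_) (enumerate-complete (P? ∘ (inside ∷_)) p))
enumerate-complete {suc n} P? {outside ∷ X} p =
  ∈-++⁺ʳ (map (inside ∷_) (enumerate (P? ∘ (inside ∷_))))
         (∈-map⁺ (outside ∷_) (enumerate-complete (P? ∘ (outside ∷_)) p))

enumerate-unique : ∀ {n} {P : Subset n → Set} (P? : ∀ X → Dec (P X)) → Unique (enumerate P?)
enumerate-unique {zero} P? with P? []
... | yes _ = [] ∷ []
... | no  _ = []
enumerate-unique {suc n} P? = Uniqueₚ.++⁺ (Uniqueₚ.map⁺ ∷-injectiveʳ (enumerate-unique (P? ∘ (inside ∷_))))
                                         (Uniqueₚ.map⁺ ∷-injectiveʳ (enumerate-unique (P? ∘ (outside ∷_)))) disjoint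
  where
  ∷-injectiveʳ : ∀ {b} {X Y : Subset n} → b ∷ X ≡ b ∷ Y → X ≡ Y
  ∷-injectiveʳ refl = refl
  disjoint : ∀ {Z} → ¬ (Z ∈ₗ map (inside ∷_) (enumerate (P? ∘ (inside ∷_)))
                     × Z ∈ₗ map (outside ∷_) (enumerate (P? ∘ (outside ∷_))))
  disjoint (Z∈ᵢ , Z∈ₒ) with _ , _ , refl ← ∈-map⁻ (inside ∷_) Z∈ᵢ with _ , _ , () ← ∈-map⁻ (outside ∷_) Z∈ₒ

count : ∀ {n} {P : Subset n → Set} → (∀ X → Dec (P X)) → ℕ
count P? = length (enumerate P?)

count-∷ : ∀ {n} {P : Subset (suc n) → Set} (P? : ∀ X → Dec (P X)) →
          count P? ≡ count (P? ∘ (inside ∷_)) + count (P? ∘ (outside ∷_))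
count-∷ {n} P? = trans (Listₚ.length-++ (map add-inside (enumerate (P? ∘ add-inside))))
                       (cong₂ _+_ (Listₚ.length-map add-inside (enumerate (P? ∘ add-inside)))
                                  (Listₚ.length-map add-outside (enumerate (P? ∘ add-outside))))
  where
  add-inside add-outside : Subset n → Subset (suc n)
  add-inside  = inside ∷_
  add-outside = outside ∷_

length-unique : ∀ {A : Set} {xs ys : List A} → Unique xs → Unique ys → (∀ {z} → z ∈ₗ xs ⇔ z ∈ₗ ys) →
                length xs ≡ length ys
length-unique xs! ys! same = ↭-length (∼bag⇒↭ (unique∧set⇒bag xs! ys! same))

count-cong : ∀ {n} {P Q : Subset n → Set} (P? : ∀ X → Dec (P X)) (Q? : ∀ X → Dec (Q X)) →
             (∀ X → P X ⇔ Q X) → count P? ≡ count Q?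
count-cong P? Q? P⇔Q = length-unique (enumerate-unique P?) (enumerate-unique Q?) λ {X} → mk⇔
  (enumerate-complete Q? ∘ Equivalence.to (P⇔Q X) ∘ enumerate-sound P?)
  (enumerate-complete P? ∘ Equivalence.from (P⇔Q X) ∘ enumerate-sound Q?)

count-none : ∀ {n} {P : Subset n → Set} (P? : ∀ X → Dec (P X)) → (∀ X → ¬ P X) → count P? ≡ 0
count-none P? ¬P with enumerate P? | enumerate-sound P?
... | []    | _     = refl
... | X ∷ _ | sound = contradiction (sound (hereₗ refl)) (¬P X)

odd-count⇒∃ : ∀ {n} {P : Subset n → Set} (P? : ∀ X → Dec (P X)) → parity (count P?) ≡ 1ℙ → ∃ P
odd-count⇒∃ P? odd with enumerate P? | enumerate-sound P?
... | X ∷ _ | sound = X , sound (hereₗ refl)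

⟦_⟧ : ∀ {A : Set} → Dec A → Parity
⟦ yes _ ⟧ = 1ℙ
⟦ no  _ ⟧ = 0ℙ

⟦⟧-cong : ∀ {A B : Set} → A ⇔ B → (a? : Dec A) (b? : Dec B) → ⟦ a? ⟧ ≡ ⟦ b? ⟧
⟦⟧-cong A⇔B (yes a)  (yes b)  = refl
⟦⟧-cong A⇔B (yes a)  (no  ¬b) = contradiction (Equivalence.to A⇔B a) ¬b
⟦⟧-cong A⇔B (no  ¬a) (yes b)  = contradiction (Equivalence.from A⇔B b) ¬a
⟦⟧-cong A⇔B (no  ¬a) (no  ¬b) = refl

⟦⟧-xor : ∀ {A B C : Set} → (C → A ⇔ (¬ B)) → (¬ C → A ⇔ B) → (a? : Dec A) (b? : Dec B) (c? : Dec C) →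
         ⟦ a? ⟧ ≡ ⟦ b? ⟧ ℙ.+ ⟦ c? ⟧
⟦⟧-xor C⇒ ¬C⇒ (yes a)  (yes b)  (yes c)  = contradiction b (Equivalence.to (C⇒ c) a)
⟦⟧-xor C⇒ ¬C⇒ (yes a)  (no  ¬b) (yes c)  = refl
⟦⟧-xor C⇒ ¬C⇒ (no  ¬a) (yes b)  (yes c)  = refl
⟦⟧-xor C⇒ ¬C⇒ (no  ¬a) (no  ¬b) (yes c)  = contradiction (Equivalence.from (C⇒ c) ¬b) ¬a
⟦⟧-xor C⇒ ¬C⇒ (yes a)  (yes b)  (no  ¬c) = refl
⟦⟧-xor C⇒ ¬C⇒ (yes a)  (no  ¬b) (no  ¬c) = contradiction (Equivalence.to (¬C⇒ ¬c) a) ¬b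
⟦⟧-xor C⇒ ¬C⇒ (no  ¬a) (yes b)  (no  ¬c) = contradiction (Equivalence.from (¬C⇒ ¬c) b) ¬a
⟦⟧-xor C⇒ ¬C⇒ (no  ¬a) (no  ¬b) (no  ¬c) = refl

-- Parity of the number of bases

#bases : ∀ {n} → Subspace n → ℕ
#bases L = count (Basis? L)

module _ {n} (L : Subspace (suc n)) where

  private
    D = delete₀ L
    C = contract₀ L
    open ≡-Reasoning

    inside? : ∀ X → Dec (Basis L (inside ∷ X))
    inside? X = Basis? L (inside ∷ X)

    outside? : ∀ X → Dec (Basis L (outside ∷ X))
    outside? X = Basis? L (outside ∷ X)

  #bases-loop : Loop L → #bases L ≡ #bases D
  #bases-loop loop = begin
    #bases L                                                             ≡⟨ count-∷ (Basis? L) ⟩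
    count inside? + count outside?                                       ≡⟨ cong₂ _+_ none same ⟩
    0 + #bases D                                                         ∎
    where
    none = count-none inside? (λ X → loop-dependent L loop ∘ proj₁)
    same = count-cong outside? (Basis? D) (λ X → mk⇔ (Basis-delete⇒ L) (Basis-delete⇐ L (loop-dependent L loop)))

  #bases-coloop : Coloop L → #bases L ≡ #bases D
  #bases-coloop coloop = begin
    #bases L                                                             ≡⟨ count-∷ (Basis? L) ⟩
    count inside? + count outside?                                       ≡⟨ cong₂ _+_ same none ⟩
    #bases D + 0                                                         ≡⟨ ℕₚ.+-identityʳ _ ⟩
    #bases D                                                             ∎
    where
    same = count-cong inside? (Basis? D) (λ X → mk⇔ (Basis-coloop⇒ L coloop) (Basis-coloop⇐ L coloop))
    none = count-none outside? (λ X → Basis-coloop-outside L coloop)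

  #bases-split : ¬ Loop L → ∀ {u} → L ∋ u → u zero ≡ 𝟙 → #bases L ≡ #bases C + #bases D
  #bases-split ¬loop u∈L u₀≡𝟙 = trans (count-∷ (Basis? L)) (cong₂ _+_ contracted deleted)
    where
    contracted = count-cong inside? (Basis? C) (λ X → mk⇔ (Basis-contract⇒ L ¬loop) (Basis-contract⇐ L ¬loop))
    deleted = count-cong outside? (Basis? D) (λ X → mk⇔ (Basis-delete⇒ L)
                (λ X-basis → Basis-delete⇐ L (head-𝟙⇒dependent L u∈L u₀≡𝟙 X-basis) X-basis))

parity-#bases : ∀ {n} (L : Subspace n) → parity (#bases L) ≡ ⟦ nondegenerate? L ⟧
parity-#bases {zero} L with Basis? L [] | nondegenerate? L
... | yes _     | yes _      = refl
... | yes _     | no ¬nondeg = contradiction (λ _ _ ()) ¬nondeg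
... | no ¬basis | _          = contradiction ((λ _ _ _ ()) , λ ()) ¬basis
parity-#bases {suc n} L with L ∋? (𝟙 ∷ᶠ 0ᵥ) | coloop? L
... | yes loop | _ = begin
  parity (#bases L)      ≡⟨ cong parity (#bases-loop L loop) ⟩
  parity (#bases D)      ≡⟨ parity-#bases D ⟩
  ⟦ nondegenerate? D ⟧   ≡⟨ ⟦⟧-cong (nondegenerate-loop L loop) (nondegenerate? L) (nondegenerate? D) ⟨
  ⟦ nondegenerate? L ⟧   ∎
  where
  open ≡-Reasoning
  D = delete₀ L
... | no _ | yes coloop = begin
  parity (#bases L)      ≡⟨ cong parity (#bases-coloop L coloop) ⟩
  parity (#bases D)      ≡⟨ parity-#bases D ⟩
  ⟦ nondegenerate? D ⟧   ≡⟨ ⟦⟧-cong (nondegenerate-coloop L coloop) (nondegenerate? L) (nondegenerate? D) ⟨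
  ⟦ nondegenerate? L ⟧   ∎
  where
  open ≡-Reasoning
  D = delete₀ L
... | no ¬loop | no ¬coloop with u , u∈L , u₀≡𝟙 ← ¬coloop⇒head-𝟙 L ¬coloop = begin
  parity (#bases L)                                  ≡⟨ cong parity (#bases-split L ¬loop u∈L u₀≡𝟙) ⟩
  parity (#bases C + #bases D)                       ≡⟨ +-homo-+ (#bases C) (#bases D) ⟩
  parity (#bases C) ℙ.+ parity (#bases D)            ≡⟨ cong₂ ℙ._+_ (parity-#bases C) (parity-#bases D) ⟩
  ⟦ nondegenerate? C ⟧ ℙ.+ ⟦ nondegenerate? D ⟧      ≡⟨ xor ⟨
  ⟦ nondegenerate? L ⟧                               ∎
  where
  open ≡-Reasoning
  D = delete₀ L
  C = contract₀ L
  nondeg-D : Nondegenerate D → Nondegenerate L ⇔ (¬ Nondegenerate C)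
  nondeg-D nondeg = mk⇔ (not-all-nondegenerate L ¬loop u∈L u₀≡𝟙 nondeg)
                        (nondegenerate-from-delete L ¬loop u∈L u₀≡𝟙 nondeg)
  xor = ⟦⟧-xor nondeg-D (degenerate-delete⇒nondegenerate⇔ L ¬loop u∈L u₀≡𝟙)
               (nondegenerate? L) (nondegenerate? C) (nondegenerate? D)

nondegenerate⇔odd : ∀ {n} (L : Subspace n) → Nondegenerate L ⇔ (parity (#bases L) ≡ 1ℙ)
nondegenerate⇔odd L with nondegenerate? L | parity-#bases L
... | yes nondeg | odd  = mk⇔ (λ _ → odd) (λ _ → nondeg)
... | no ¬nondeg | even = mk⇔ (λ nondeg → contradiction nondeg ¬nondeg)
                               (λ odd → contradiction (trans (sym even) odd) λ ())

-- coordinates outside X are free in L ↾ X, so its bases are the bases of L inside X when X spans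
infixl 5 _↾_
_↾_ : ∀ {n} → Subspace n → Subset n → Subspace n
L ↾ X = record
  { Carrier = λ v → L ∋ mask X v
  ; _∋?_    = λ v → L ∋? mask X v
  ; ∋-resp  = λ e → ∋-resp L (mask-cong X e)
  ; ∋-0ᵥ    = ∋-resp L (sym ∘ mask-zero X) (∋-0ᵥ L)
  ; ∋-+ᵥ    = λ {v} {w} p q → ∋-resp L (sym ∘ mask-+ X v w) (∋-+ᵥ L p q)
  ; ∋-·ᵥ    = λ c {v} p → ∋-resp L (sym ∘ mask-· X c v) (∋-·ᵥ L c p)
  }

module _ {n} (L : Subspace n) {X : Subset n} where

  ∈-↾ : ∀ {v} → SupportedIn v X → L ∋ v → L ↾ X ∋ v
  ∈-↾ s = ∋-resp L (sym ∘ mask-supported s)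

  ∈-↾⁻ : ∀ {v} → SupportedIn v X → L ↾ X ∋ v → L ∋ v
  ∈-↾⁻ s = ∋-resp L (mask-supported s)

  unit-∈-↾ : ∀ {j} → j ∉ X → L ↾ X ∋ unit j
  unit-∈-↾ {j} j∉X = ∋-resp L (λ i → sym (masked i)) (∋-0ᵥ L)
    where
    masked : mask X (unit j) ≗ 0ᵥ
    masked i with i ∈? X
    ... | yes i∈X = unit-off λ { refl → j∉X i∈X }
    ... | no  _   = refl

unit-dependent : ∀ {n} (K : Subspace n) {X : Subset n} {j} → K ∋ unit j → SupportedIn (unit j) X → ¬ Indep K X
unit-dependent K {j = j} j∈K s indep = contradiction (trans (sym (unit-diag j)) (indep (unit j) j∈K s j)) λ ()

SupportedIn-unit : ∀ {n} {X : Subset n} j → SupportedIn (unit j) (X ∪ ⁅ j ⁆)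
SupportedIn-unit {X = X} j i i∉ = unit-off λ { refl → i∉ (j∈X∪⁅j⁆ X j) }

-- every coordinate outside X lies in the closure of X
Spans : ∀ {n} → Subspace n → Subset n → Set
Spans {n} L X = ∀ j → j ∉ X → ∃[ v ] L ∋ v × SupportedIn v (X ∪ ⁅ j ⁆) × v j ≢ 𝟘

family⇒spans : ∀ {n} {K L : Subspace n} {B X} → (∀ {v} → K ∋ v → L ∋ v) →
               FundamentalFamily K B → B ⊆ X → Spans L X
family⇒spans K⊆L F B⊆X j j∉X =
  r j , K⊆L (r-∈ j) , supported , λ rjj≡𝟘 → contradiction (trans (sym (r-diag j∉B)) rjj≡𝟘) λ ()
  where
  open FundamentalFamily F
  j∉B = j∉X ∘ B⊆X
  supported : SupportedIn (r j) (_ ∪ ⁅ j ⁆)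
  supported i i∉ = r-off (λ { refl → i∉ (j∈X∪⁅j⁆ _ i) }) (λ i∈B → i∉ (p⊆p∪q _ (B⊆X i∈B)))

module _ {n} (L : Subspace n) {B X : Subset n} where

  Basis-↾⁺ : Basis L B → B ⊆ X → Basis (L ↾ X) B
  Basis-↾⁺ (indep , max) B⊆X = indep′ , max′
    where
    indep′ : Indep (L ↾ X) B
    indep′ v v∈ s = indep v (∈-↾⁻ L (SupportedIn-mono B⊆X s) v∈) s
    max′ : ∀ j → j ∉ B → ¬ Indep (L ↾ X) (B ∪ ⁅ j ⁆)
    max′ j j∉B indep″ with j ∈? X
    ... | yes j∈X = max j j∉B λ v v∈L s → indep″ v (∈-↾ L (SupportedIn-mono (∪⁅⁆-⊆ B⊆X j∈X) s) v∈L) s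
    ... | no  j∉X = unit-dependent (L ↾ X) (unit-∈-↾ L j∉X) (SupportedIn-unit j) indep″

  Basis-↾⁻ : Spans L X → Basis (L ↾ X) B → Basis L B × B ⊆ X
  Basis-↾⁻ spans B-basis@(indep , max) = (indep′ , max′) , B⊆X
    where
    B⊆X : B ⊆ X
    B⊆X {i} i∈B with i ∈? X
    ... | yes i∈X = i∈X
    ... | no  i∉X = contradiction indep (unit-dependent (L ↾ X) (unit-∈-↾ L i∉X) supported)
      where
      supported : SupportedIn (unit i) B
      supported k k∉B = unit-off λ { refl → k∉B i∈B }
    indep′ : Indep L B
    indep′ v v∈L s = indep v (∈-↾ L (SupportedIn-mono B⊆X s) v∈L) s
    max′ : ∀ j → j ∉ B → ¬ Indep L (B ∪ ⁅ j ⁆)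
    max′ j j∉B indep″ with j ∈? X
    ... | yes j∈X = max j j∉B λ v v∈ s → indep″ v (∈-↾⁻ L (SupportedIn-mono (∪⁅⁆-⊆ B⊆X j∈X) s) v∈) s
    ... | no  j∉X with v , v∈L , v-supp , vj≢𝟘 ← spans j j∉X =
      vj≢𝟘 (trans (sym (trans (cong (v j ⊕_) (mask-∉ _ j∉X)) (⊕-identityʳ (v j)))) (indep″ w w∈L w-supp j))
      where
      -- clear the X-part of v using coordinates with respect to B
      open Coordinates (basis⇒family (L ↾ X) B-basis)
      w = v +ᵥ mask X (lincomb v)
      w∈L : L ∋ w
      w∈L = ∋-+ᵥ L v∈L (lincomb-∈ (L ↾ X) r-∈ v)
      w-supp : SupportedIn w (B ∪ ⁅ j ⁆)
      w-supp i i∉ with i ∈? X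
      ... | yes i∈X = trans (cong (v i ⊕_) (lincomb-outside v (i∉ ∘ p⊆p∪q _))) (⊕-self (v i))
      ... | no  i∉X = trans (⊕-identityʳ (v i)) (v-supp i (∉-∪⁅⁆ (λ { refl → i∉ (j∈X∪⁅j⁆ B i) }) i∉X))

-- Bases of the radical

BasisIn : ∀ {n} → Subspace n → Subset n → Subset n → Set
BasisIn L X B = Basis L B × B ⊆ X

basisIn? : ∀ {n} (L : Subspace n) X B → Dec (BasisIn L X B)
basisIn? L X B = Basis? L B ×-dec (B ⊆? X)

OddBasesIn : ∀ {n} → Subspace n → SetSystem n
OddBasesIn L X = parity (count (basisIn? L X)) ≡ 1ℙ

⟨⟩-mask : ∀ {n} {u : Vect n} {X} → SupportedIn u X → ∀ w → ⟨ u , w ⟩ ≡ ⟨ u , mask X w ⟩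
⟨⟩-mask {u = u} {X} s w = sumF-cong pointwise
  where
  pointwise : ∀ i → u i ⊗ inv (w i) ≡ u i ⊗ inv (mask X w i)
  pointwise i with i ∈? X
  ... | yes _   = refl
  ... | no  i∉X = trans (cong (λ a → a ⊗ inv (w i)) (s i i∉X)) (cong (λ a → a ⊗ 𝟘) (sym (s i i∉X)))

module _ {n} (L : Subspace n) where

  #basesIn-↾ : ∀ {X} → Spans L X → count (basisIn? L X) ≡ #bases (L ↾ X)
  #basesIn-↾ {X} spans = count-cong (basisIn? L X) (Basis? (L ↾ X))
    (λ B → mk⇔ (λ (B-basis , B⊆X) → Basis-↾⁺ L B-basis B⊆X) (Basis-↾⁻ L spans))

  odd⇒radical-independent : ∀ {X} → OddBasesIn L X → Indep (radical L) X
  odd⇒radical-independent {X} odd u (u∈L , u⊥L) u-supp =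
    nondeg u (∈-↾ L u-supp u∈L , λ w w∈ → trans (⟨⟩-mask u-supp w) (u⊥L _ w∈))
    where
    B-in-X = proj₂ (odd-count⇒∃ (basisIn? L X) odd)
    spans : Spans L X
    spans = family⇒spans {K = L} {L = L} {X = X} (λ v∈L → v∈L) (basis⇒family L (proj₁ B-in-X)) (proj₂ B-in-X)
    nondeg : Nondegenerate (L ↾ X)
    nondeg = Equivalence.from (nondegenerate⇔odd (L ↾ X)) (trans (cong parity (sym (#basesIn-↾ spans))) odd)

  radical-basis⇒odd : ∀ {B} → Basis (radical L) B → OddBasesIn L B
  radical-basis⇒odd {B} B-basis@(B-indep , _) =
    trans (cong parity (#basesIn-↾ spans)) (Equivalence.to (nondegenerate⇔odd (L ↾ B)) nondeg)
    where
    F = basis⇒family (radical L) B-basis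
    open Coordinates F
    spans : Spans L B
    spans = family⇒spans {K = radical L} {L = L} {X = B} proj₁ F ⊆-refl
    nondeg : Nondegenerate (L ↾ B)
    nondeg w (w∈ , w⊥) = B-indep w (w∈L , w⊥L) w-supp
      where
      w-supp : SupportedIn w B
      w-supp i i∉B = trans (sym (⟨⟩-unit w i)) (w⊥ (unit i) (unit-∈-↾ L i∉B))
      w∈L = ∈-↾⁻ L w-supp w∈
      -- y splits into a vector supported on B and a combination of radical vectors
      w⊥L : ∀ y → L ∋ y → ⟨ w , y ⟩ ≡ 𝟘
      w⊥L y y∈L = begin
        ⟨ w , y ⟩                                   ≡⟨ ⟨⟩-congʳ w (sym ∘ +ᵥ-cancelʳ y (lincomb y)) ⟩
        ⟨ w , (y +ᵥ lincomb y) +ᵥ lincomb y ⟩       ≡⟨ ⟨⟩-+ʳ w (y +ᵥ lincomb y) (lincomb y) ⟩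
        ⟨ w , y +ᵥ lincomb y ⟩ ⊕ ⟨ w , lincomb y ⟩  ≡⟨ cong₂ _⊕_ residual⊥ family⊥ ⟩
        𝟘                                           ∎
        where
        open ≡-Reasoning
        residual⊥ = w⊥ (y +ᵥ lincomb y) (∈-↾ L (residual-supported y) (∋-+ᵥ L y∈L (lincomb-∈ L (proj₁ ∘ r-∈) y)))
        family⊥ = lincomb-∈ (annihilator w) (λ j → trans (⟨⟩-sym (r j) w) (cong inv (proj₂ (r-∈ j) w w∈L))) y

  radical-basis⇔max-odd : ∀ X → Basis (radical L) X ⇔ maxS (OddBasesIn L) X
  radical-basis⇔max-odd X = mk⇔ to from
    where
    to : Basis (radical L) X → maxS (OddBasesIn L) X
    to X-basis = radical-basis⇒odd X-basis ,
                 λ Y odd X⊆Y → Basis-maximal (radical L) X-basis (odd⇒radical-independent odd) X⊆Y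
    not-maximal : (∀ Y → OddBasesIn L Y → X ⊆ Y → Y ≡ X) → ∀ {j} → j ∉ X →
                  ¬ (∃[ B ] Basis (radical L) B × X ∪ ⁅ j ⁆ ⊆ B)
    not-maximal max {j} j∉X (B , B-basis , Xj⊆B) =
      j∉X (subst (j ∈_) (max B (radical-basis⇒odd B-basis) (⊆-trans (p⊆p∪q _) Xj⊆B)) (Xj⊆B (j∈X∪⁅j⁆ X j)))
    from : maxS (OddBasesIn L) X → Basis (radical L) X
    from (odd , max) = odd⇒radical-independent odd ,
                       λ j j∉X indep → not-maximal max j∉X (extend-to-basis (radical L) indep)

support : ∀ {n} → Vect n → Subset n
support v = tabulate (λ i → not (does (v i ≟ 𝟘)))

isSupport : ∀ {n} (v : Vect n) → IsSupport v (support v)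
isSupport v i = mk⇔
  (Equivalence.to (nonzero⇔ (v i)) ∘ trans (sym (lookup∘tabulate _ i)) ∘ []=⇒lookup)
  (lookup⇒[]= i _ ∘ trans (lookup∘tabulate _ i) ∘ Equivalence.from (nonzero⇔ (v i)))
  where
  nonzero⇔ : ∀ x → not (does (x ≟ 𝟘)) ≡ true ⇔ x ≢ 𝟘
  nonzero⇔ 𝟘  = mk⇔ (λ ()) (λ 𝟘≢𝟘 → contradiction refl 𝟘≢𝟘)
  nonzero⇔ 𝟙  = mk⇔ (λ _ ()) (λ _ → refl)
  nonzero⇔ ω  = mk⇔ (λ _ ()) (λ _ → refl)
  nonzero⇔ ω² = mk⇔ (λ _ ()) (λ _ → refl)

IsSupport-unique : ∀ {n} {v : Vect n} {X Y} → IsSupport v X → IsSupport v Y → X ≡ Y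
IsSupport-unique X-supp Y-supp = ⊆-antisym (λ {i} → Equivalence.from (Y-supp i) ∘ Equivalence.to (X-supp i))
                                           (λ {i} → Equivalence.from (X-supp i) ∘ Equivalence.to (Y-supp i))

support-cong : ∀ {n} {v w : Vect n} → v ≗ w → support v ≡ support w
support-cong e = tabulate-cong (λ i → cong (λ a → not (does (a ≟ 𝟘))) (e i))

⊆∧≢⇒∣<∣ : ∀ {n} {X Y : Subset n} → X ⊆ Y → X ≢ Y → ∣ X ∣ < ∣ Y ∣
⊆∧≢⇒∣<∣ {n} {X} {Y} X⊆Y X≢Y = p⊂q⇒∣p∣<∣q∣ (X⊆Y , i , ¬→⇒×¬ (i ∈? Y) Y⊈X)
  where
  witness = Finₚ.¬∀⟶∃¬ n (λ i → i ∈ Y → i ∈ X) (λ i → i ∈? Y →-dec i ∈? X)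
              (λ Y⊆X → X≢Y (⊆-antisym X⊆Y (λ {i} → Y⊆X i)))
  i = proj₁ witness
  Y⊈X = proj₂ witness

module _ {n} (L′ : VSet n) (K : Subspace n) (L′⇒K : ∀ {v} → L′ v → K ∋ v) (K⇒L′ : ∀ {v} → K ∋ v → L′ v) where

  private
    NotBelow : Vect n → Vect n → Set
    NotBelow w w′ = ¬ w′ ≗ 0ᵥ → support w′ ⊆ support w → support w′ ≡ support w

    notBelow-resp : ∀ w → Extensional (NotBelow w)
    notBelow-resp w e h w₂≢0 ⊆w = trans (sym (support-cong e))
      (h (λ z → w₂≢0 (λ i → trans (sym (e i)) (z i))) (subst (_⊆ support w) (sym (support-cong e)) ⊆w))

    notBelow? : ∀ w w′ → Dec (NotBelow w w′)
    notBelow? w w′ =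
      ¬? (≗0ᵥ? w′) →-dec (support w′ ⊆? support w →-dec Vecₚ.≡-dec Boolₚ._≟_ (support w′) (support w))

  circuit-within : ∀ w → Acc _<_ ∣ support w ∣ → K ∋ w → ¬ w ≗ 0ᵥ → ∃[ C ] Circuit L′ C × C ⊆ support w
  circuit-within w (acc smaller) w∈K w≢0 with all∈? K (notBelow-resp w) (notBelow? w)
  ... | yes minimal = support w , (nonempty , (w , K⇒L′ w∈K , isSupport w) , minimal′) , λ i∈ → i∈
    where
    nonempty : Nonempty (support w)
    nonempty with i , wi≢𝟘 ← nonzero-coordinate w≢0 = i , Equivalence.from (isSupport w i) wi≢𝟘
    minimal′ : ∀ D → Nonempty D → SupportIn L′ D → D ⊆ support w → D ≡ support w
    minimal′ D (i , i∈D) (y , y∈L′ , y-supp) D⊆ =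
      trans D≡ (minimal y (L′⇒K y∈L′) (λ y≗0 → Equivalence.to (y-supp i) i∈D (y≗0 i)) (subst (_⊆ support w) D≡ D⊆))
      where D≡ = IsSupport-unique y-supp (isSupport y)
  ... | no ¬minimal
    with w′ , w′∈K , ¬notBelow ← ¬∀∈⇒∃∈¬ K (notBelow-resp w) (notBelow? w) ¬minimal
    with w′≢0 , ¬notBelow′ ← ¬→⇒×¬ (¬? (≗0ᵥ? w′)) ¬notBelow
    with ⊆w , ≢w ← ¬→⇒×¬ (support w′ ⊆? support w) ¬notBelow′
    with C , C-circuit , C⊆ ← circuit-within w′ (smaller (⊆∧≢⇒∣<∣ ⊆w ≢w)) w′∈K w′≢0 = C , C-circuit , ⊆-trans C⊆ ⊆w

  Indep⇒Independent : ∀ {X} → Indep K X → Independent L′ X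
  Indep⇒Independent indep C ((i , i∈C) , (v , v∈L′ , v-supp) , _) C⊆X =
    Equivalence.to (v-supp i) i∈C (indep v (L′⇒K v∈L′) supported i)
    where
    supported : SupportedIn v _
    supported k k∉X with v k ≟ 𝟘
    ... | yes vk≡𝟘 = vk≡𝟘
    ... | no  vk≢𝟘 = contradiction (C⊆X (Equivalence.from (v-supp k) vk≢𝟘)) k∉X

  Independent⇒Indep : ∀ {X} → Independent L′ X → Indep K X
  Independent⇒Indep {X} independent v v∈K v-supp i with v i ≟ 𝟘
  ... | yes vi≡𝟘 = vi≡𝟘
  ... | no  vi≢𝟘 with C , C-circuit , C⊆ ← circuit-within v (<-wellFounded _) v∈K (λ v≗0 → vi≢𝟘 (v≗0 i)) =
    ⊥-elim (independent C C-circuit (⊆-trans C⊆ support⊆X))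
    where
    support⊆X : support v ⊆ X
    support⊆X {k} k∈ with k ∈? X
    ... | yes k∈X = k∈X
    ... | no  k∉X = contradiction (v-supp k k∉X) (Equivalence.to (isSupport v k) k∈)

  Bases⇔Basis : ∀ X → Bases L′ X ⇔ Basis K X
  Bases⇔Basis X = mk⇔ to from
    where
    to : Bases L′ X → Basis K X
    to (independent , max) = Independent⇒Indep independent , λ j j∉X indep →
      j∉X (subst (j ∈_) (max _ (Indep⇒Independent indep) (p⊆p∪q _)) (j∈X∪⁅j⁆ X j))
    from : Basis K X → Bases L′ X
    from X-basis = Indep⇒Independent (proj₁ X-basis) ,
      λ Y independent X⊆Y → Basis-maximal K X-basis (Independent⇒Indep independent) X⊆Y

dot-congʳ : ∀ {n} (x : Vect n) {v w} → v ≗ w → dot x v ≡ dot x w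
dot-congʳ x e = sumF-cong (λ i → cong (x i ⊗_) (e i))

dot-zeroʳ : ∀ {n} (x : Vect n) → dot x 0ᵥ ≡ 𝟘
dot-zeroʳ x = sumF-zero (λ i → ⊗-zeroʳ (x i))

dot-+ʳ : ∀ {n} (x v w : Vect n) → dot x (v +ᵥ w) ≡ dot x v ⊕ dot x w
dot-+ʳ x v w =
  trans (sumF-cong (λ i → ⊗-distribˡ-⊕ (x i) (v i) (w i))) (sumF-⊕ (λ i → x i ⊗ v i) (λ i → x i ⊗ w i))

dot-·ʳ : ∀ {n} (x : Vect n) c v → dot x (c ·ᵥ v) ≡ c ⊗ dot x v
dot-·ʳ x c v = trans (sumF-cong (λ i → swap (x i) c (v i))) (sumF-⊗ c (λ i → x i ⊗ v i))
  where
  swap : ∀ a b d → a ⊗ (b ⊗ d) ≡ b ⊗ (a ⊗ d)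
  swap = from-yes (all? λ a → all? λ b → all? λ d → a ⊗ (b ⊗ d) ≟ b ⊗ (a ⊗ d))

kernel : ∀ {m n} → (Fin m → Fin n → GF4) → Subspace n
kernel A = record
  { Carrier = ker A
  ; _∋?_    = λ v → Finₚ.all? (λ r → dot (A r) v ≟ 𝟘)
  ; ∋-resp  = λ e v∈ r → trans (sym (dot-congʳ (A r) e)) (v∈ r)
  ; ∋-0ᵥ    = λ r → dot-zeroʳ (A r)
  ; ∋-+ᵥ    = λ {v} {w} v∈ w∈ r → trans (dot-+ʳ (A r) v w) (cong₂ _⊕_ (v∈ r) (w∈ r))
  ; ∋-·ᵥ    = λ c {v} v∈ r → trans (dot-·ʳ (A r) c v) (trans (cong (c ⊗_) (v∈ r)) (⊗-zeroʳ c))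
  }

-- v ∈ inv (L⊥) says exactly that ⟨ y , v ⟩ = dot y (inv v) vanishes on L
BC⇔Radical : ∀ {n} (L : Subspace n) v → BC (Carrier L) v ⇔ Radical L v
BC⇔Radical L v = mk⇔
  (λ (v∈L , w , w⊥ , v≡inv-w) → v∈L , λ y y∈L → trans (⟨⟩-sym y v)
     (cong inv (trans (sumF-cong (λ i → cong (λ a → y i ⊗ inv a) (v≡inv-w i)))
                      (trans (sumF-cong (λ i → cong (y i ⊗_) (inv-involutive (w i)))) (w⊥ y y∈L)))))
  (λ (v∈L , v⊥) → v∈L , inv ∘ v , (λ y y∈L → trans (⟨⟩-sym v y) (cong inv (v⊥ y y∈L))) ,
     λ i → sym (inv-involutive (v i)))

odd⇔%2≡1 : ∀ k → parity k ≡ 1ℙ ⇔ k % 2 ≡ 1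
odd⇔%2≡1 0             = mk⇔ (λ ()) (λ ())
odd⇔%2≡1 1             = mk⇔ (λ _ → refl) (λ _ → refl)
odd⇔%2≡1 (suc (suc k)) = subst (λ r → parity k ≡ 1ℙ ⇔ r ≡ 1) (sym [2+k]%2≡k%2) (odd⇔%2≡1 k)
  where
  [2+k]%2≡k%2 : (2 + k) % 2 ≡ k % 2
  [2+k]%2≡k%2 = trans (cong (_% 2) (ℕₚ.+-comm 2 k)) ([m+n]%n≡m%n k 2)

plusV⇔OddBasesIn : ∀ {n} (M : SetSystem n) (L : Subspace n) → M ≐ Basis L → plusV M ≐ OddBasesIn L
plusV⇔OddBasesIn M L M≐ X = mk⇔ to from
  where
  in-X? = basisIn? L X
  M-in-X⇔ : ∀ Z → (M Z × Z ⊆ X) ⇔ BasisIn L X Z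
  M-in-X⇔ Z = mk⇔ (λ (Z∈M , Z⊆X) → Equivalence.to (M≐ Z) Z∈M , Z⊆X)
                  (λ (Z-basis , Z⊆X) → Equivalence.from (M≐ Z) Z-basis , Z⊆X)
  enumerate⇔ : ∀ Z → Z ∈ₗ enumerate in-X? ⇔ (M Z × Z ⊆ X)
  enumerate⇔ Z = mk⇔ (Equivalence.from (M-in-X⇔ Z) ∘ enumerate-sound in-X?)
                     (enumerate-complete in-X? ∘ Equivalence.to (M-in-X⇔ Z))

  to : plusV M X → OddBasesIn L X
  to (Zs , Zs! , Zs⇔ , odd) = Equivalence.from (odd⇔%2≡1 (count in-X?)) (subst (λ k → k % 2 ≡ 1) same-length odd)
    where
    same-length = length-unique Zs! (enumerate-unique in-X?) λ {Z} → ⇔-trans (Zs⇔ Z) (⇔-sym (enumerate⇔ Z))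

  from : OddBasesIn L X → plusV M X
  from odd = enumerate in-X? , enumerate-unique in-X? , enumerate⇔ , Equivalence.to (odd⇔%2≡1 (count in-X?)) odd

maxS-cong : ∀ {n} {E F : SetSystem n} → E ≐ F → maxS E ≐ maxS F
maxS-cong E≐F X = mk⇔
  (λ (X∈E , max) → Equivalence.to (E≐F X) X∈E , λ Y Y∈F → max Y (Equivalence.from (E≐F Y) Y∈F))
  (λ (X∈F , max) → Equivalence.from (E≐F X) X∈F , λ Y Y∈E → max Y (Equivalence.to (E≐F Y) Y∈E))

bicycle-bases : ∀ {n} (L : Subspace n) (M : SetSystem n) →
                M ≐ Bases (Carrier L) → Bases (BC (Carrier L)) ≐ maxS (plusV M)
bicycle-bases L M M≐ X =
  ⇔-trans (Bases⇔Basis (BC (Carrier L)) (radical L) BC⇒Radical Radical⇒BC X)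
  (⇔-trans (radical-basis⇔max-odd L X)
           (⇔-sym (maxS-cong (plusV⇔OddBasesIn M L M≐L) X)))
  where
  BC⇒Radical : ∀ {v} → BC (Carrier L) v → Radical L v
  BC⇒Radical = Equivalence.to (BC⇔Radical L _)
  Radical⇒BC : ∀ {v} → Radical L v → BC (Carrier L) v
  Radical⇒BC = Equivalence.from (BC⇔Radical L _)
  M≐L : M ≐ Basis L
  M≐L Z = ⇔-trans (M≐ Z) (Bases⇔Basis (Carrier L) L (λ v∈ → v∈) (λ v∈ → v∈) Z)

theorem9 : (n m : ℕ) (A : Fin m → Fin n → GF4) (M : SetSystem n)
  → M ≐ Bases (ker A)
  → Bases (BC (ker A)) ≐ maxS (plusV M)
    × ((m′ : ℕ) (A′ : Fin m′ → Fin n → GF4) → M ≐ Bases (ker A′)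
        → Bases (BC (ker A)) ≐ Bases (BC (ker A′)))
theorem9 n m A M M≐ = bicycle-bases (kernel A) M M≐ ,
  λ m′ A′ M≐′ X → ⇔-trans (bicycle-bases (kernel A) M M≐ X) (⇔-sym (bicycle-bases (kernel A′) M M≐′ X))
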